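{- Let $d\ge 1$ be an integer. A random $2d$-regular multigraph on $n$ vertices is connected with probability $1-\frac{1}{n^{d-1}}+O\left(\frac{1}{n^{d}}\right)$ as $n\to\infty$.
   Context: A random $2d$-regular multigraph on $n$ vertices is obtained by choosing $d$ permutations $\sigma_1,\dots,\sigma_d$ independently and uniformly at random from $\mathcal{S}_n$ and, starting from $n$ isolated vertices $1,\dots,n$, adding the edge $\{j,\sigma_i(j)\}$ for every $i\in\{1,\dots,d\}$ and $j\in\{1,\dots,n\}$ (loops and multiple edges allowed). -}

module Defs where

open import Data.Nat using (ℕ; zero; suc)
open import Data.Integer using (+_)
open import Data.Rational using (ℚ; _/_; 0ℚ)
open import Data.Fin using (Fin)
open import Data.Vec using (Vec; lookup)
open import Data.Product using (∃)
open import Data.Sum using (_⊎_)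
open import Relation.Binary.PropositionalEquality using (_≡_)
open import Relation.Binary.Construct.Closure.ReflexiveTransitive using (Star)

-- A permutation of {0,…,n-1} is represented by its table of values
-- (a vector of length n) whose lookup function is injective
-- (hence bijective, the set being finite).
IsPerm : {n : ℕ} → Vec (Fin n) n → Set
IsPerm {n} p = (a b : Fin n) → lookup p a ≡ lookup p b → a ≡ b

PermTuple : ℕ → ℕ → Set
PermTuple n d = Vec (Vec (Fin n) n) d

AllPerms : {n d : ℕ} → PermTuple n d → Set
AllPerms {n} {d} σ = (i : Fin d) → IsPerm (lookup σ i)

-- Adjacency in the multigraph G(σ): edges {j, σ_i(j)} for all i, j.
Adj : {n d : ℕ} → PermTuple n d → Fin n → Fin n → Set
Adj {n} {d} σ u v = ∃ λ (i : Fin d) → (lookup (lookup σ i) u ≡ v) ⊎ (lookup (lookup σ i) v ≡ u)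

Connected : {n d : ℕ} → PermTuple n d → Set
Connected {n} σ = (u v : Fin n) → Star (Adj σ) u v

-- a / b as a rational number (b = 0 ↦ 0; only used with b ≠ 0).
_÷ℕ_ : ℕ → ℕ → ℚ
a ÷ℕ zero = 0ℚ
a ÷ℕ suc b = (+ a) / suc b

module Submission where

-- Writing L for the connected tuples, b = (n−1)! and K = 40 + 4·2^d, we show for n ≥ 3
--     |L| + n b^d ≤ (n!)^d + K b^d    and    (n!)^d ≤ |L| + n b^d + K b^d,
-- which after division by (n!)^d = n^d b^d is the claim |L|/(n!)^d = 1 − 1/n^(d−1) + O(1/n^d).
--
-- Module Counting: a colouring of Fin n with classes of sizes a and b is preserved by exactly
-- a! b! permutations (enumerate injective sequences with a prescribed colour pattern), so exactly
-- (a! b!)^d tuples leave it invariant.  Then: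
--  * lower bound: a disconnected tuple leaves invariant a set of size k with 1 ≤ k ≤ n/2 (a
--    component or its complement), so (n!)^d ≤ |L| + Σ_k (n C k) (k! (n−k)!)^d, and this sum
--    is n b^d + O(b^d) because k! (n−k)! decreases for 1 ≤ k ≤ n/2;
--  * upper bound, d ≥ 2: connected tuples fix no point, and Bonferroni's inequality for the
--    events "v is fixed" gives |L| + n b^d ≤ (n!)^d + n² (2 (n−2)!)^d;
--  * upper bound, d = 1: a connected σ is an n-cycle, determined by the orbit of 0, so |L| ≤ b.
module Counting where

  open import Defs using (IsPerm; PermTuple; AllPerms; Adj; Connected)
  open import Data.Nat using (ℕ; zero; suc; _+_; _*_; _∸_; _≤_; _<_; z≤n; s≤s; _!; _^_; _≤?_; _<?_; _≟_; >-nonZero)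
  open import Data.Nat.Properties
  open import Data.Nat.Combinatorics using (_C_; nCk≡n!/k![n-k]!; k![n∸k]!∣n!; nCk+nC[k+1]≡[n+1]C[k+1]; [n-k]*d[k+1]≡[k+1]*d[k])
  open import Data.Nat.Combinatorics.Base using (_P′_)
  open import Data.Nat.Combinatorics.Specification using (nP′n≡n!)
  open import Data.Nat.DivMod using (m/n*n≡m)
  open import Data.Nat.Tactic.RingSolver using (solve-∀)
  open import Data.Bool using (Bool; true; false; not; _∨_)
  open import Data.Bool.Properties using (∨-zeroʳ) renaming (_≟_ to _≟ᵇ_)
  open import Data.Fin using (Fin; zero; suc; toℕ; fromℕ<)
  open import Data.Fin.Properties using (all?; any?; ¬∀⟶∃¬; pigeonhole; injective⇒≤; toℕ<n; toℕ-fromℕ<; toℕ-injective) renaming (_≟_ to _≟ᶠ_)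
  open import Data.List using (List; []; _∷_; _++_; length; map; concatMap; filter; allFin; upTo)
  open import Data.List.Properties using (length-map; length-++; length-tabulate; map-tabulate; ++-identityʳ; length-applyUpTo)
  open import Data.Vec using (Vec; []; _∷_; lookup; tabulate)
  import Data.Vec as Vec
  open import Data.Vec.Properties using (lookup∘tabulate; tabulate∘lookup; tabulate-cong; lookup-replicate; ≡-dec)
  import Data.Vec.Relation.Unary.All as VAll
  open import Data.Vec.Relation.Unary.All using ([]; _∷_)
  import Data.Vec.Relation.Unary.Any as VAny
  open import Data.Vec.Relation.Unary.Any using (here; there)
  open import Data.Vec.Relation.Unary.AllPairs using ([]; _∷_)
  import Data.Vec.Relation.Unary.Unique.Propositional as VUnique
  import Data.Vec.Relation.Unary.Unique.Propositional.Properties as VUniqueₚ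
  import Data.Vec.Membership.Propositional as VMem
  open import Data.Vec.Relation.Binary.Pointwise.Inductive using (Pointwise; []; _∷_)
  import Data.Vec.Relation.Binary.Pointwise.Inductive as Pointwise
  open import Data.Vec.Relation.Binary.Pointwise.Extensional using (ext; extensional⇒inductive)
  import Data.List.Relation.Unary.Any as Any
  open import Data.List.Relation.Unary.Any using (here; there)
  open import Data.List.Relation.Unary.All using (All; []; _∷_)
  import Data.List.Relation.Unary.All as All
  import Data.List.Relation.Unary.All.Properties as Allₚ
  open import Data.List.Relation.Unary.AllPairs using ([]; _∷_)
  import Data.List.Relation.Unary.AllPairs as AllPairs
  import Data.List.Relation.Unary.AllPairs.Properties as AllPairsₚ
  open import Data.List.Relation.Unary.Unique.Propositional using (Unique)
  import Data.List.Relation.Unary.Unique.Propositional.Properties as Unique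
  open import Data.List.Membership.Propositional using (_∈_; _∉_; find; lose)
  open import Data.List.Membership.Propositional.Properties
    using (∈-map⁺; ∈-map⁻; ∈-concatMap⁺; ∈-concatMap⁻; ∈-filter⁺; ∈-filter⁻; ∈-allFin; ∈-upTo⁺; ∈-upTo⁻)
  open import Data.Product using (∃; _×_; _,_; proj₁; proj₂)
  open import Data.Sum using (_⊎_; inj₁; inj₂)
  open import Data.Empty using (⊥; ⊥-elim)
  open import Relation.Nullary using (¬_; Dec; yes; no)
  open import Relation.Nullary.Decidable using (_×-dec_; ¬?; toSum; does; ¬¬-excluded-middle; decidable-stable; dec-true; dec-false; does-⇔)
  open import Function using (_∘_; id)
  open import Function.Bundles using (_⇔_; mk⇔; Equivalence)
  open import Relation.Binary.Construct.Closure.ReflexiveTransitive using (Star; ε; _◅_; _◅◅_; reverse)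
  open import Relation.Binary.PropositionalEquality
  open import Relation.Binary.Definitions using (tri<; tri≈; tri>)

  private variable
    A B : Set
    P Q R : Set

  ∑ : List A → (A → ℕ) → ℕ
  ∑ [] f = 0
  ∑ (x ∷ xs) f = f x + ∑ xs f

  syntax ∑ xs (λ x → e) = ∑[ x ← xs ] e

  ∑-cong : (xs : List A) {f g : A → ℕ} → (∀ x → x ∈ xs → f x ≡ g x) → ∑ xs f ≡ ∑ xs g
  ∑-cong [] h = refl
  ∑-cong (x ∷ xs) h = cong₂ _+_ (h x (here refl)) (∑-cong xs (λ y p → h y (there p)))

  ∑-mono : (xs : List A) {f g : A → ℕ} → (∀ x → x ∈ xs → f x ≤ g x) → ∑ xs f ≤ ∑ xs g
  ∑-mono [] h = z≤n
  ∑-mono (x ∷ xs) h = +-mono-≤ (h x (here refl)) (∑-mono xs (λ y p → h y (there p)))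

  ∑-+ : (xs : List A) (f g : A → ℕ) → ∑[ x ← xs ] (f x + g x) ≡ ∑ xs f + ∑ xs g
  ∑-+ [] f g = refl
  ∑-+ (x ∷ xs) f g = trans (cong (f x + g x +_) (∑-+ xs f g)) (+-interchange (f x) (g x) (∑ xs f) (∑ xs g))
    where
    +-interchange : ∀ a b c d → a + b + (c + d) ≡ a + c + (b + d)
    +-interchange = solve-∀

  ∑-const : (xs : List A) (c : ℕ) → ∑[ _ ← xs ] c ≡ length xs * c
  ∑-const [] c = refl
  ∑-const (x ∷ xs) c = cong (c +_) (∑-const xs c)

  ∑-*ˡ : (xs : List A) (c : ℕ) (f : A → ℕ) → ∑[ x ← xs ] (c * f x) ≡ c * ∑ xs f
  ∑-*ˡ [] c f = sym (*-zeroʳ c)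
  ∑-*ˡ (x ∷ xs) c f = trans (cong (c * f x +_) (∑-*ˡ xs c f)) (sym (*-distribˡ-+ c (f x) (∑ xs f)))

  ∑-swap : (xs : List A) (ys : List B) (f : A → B → ℕ) →
    ∑[ x ← xs ] ∑[ y ← ys ] f x y ≡ ∑[ y ← ys ] ∑[ x ← xs ] f x y
  ∑-swap [] ys f = sym (trans (∑-const ys 0) (*-zeroʳ (length ys)))
  ∑-swap (x ∷ xs) ys f = trans (cong (∑ ys (f x) +_) (∑-swap xs ys f)) (sym (∑-+ ys (f x) _))

  ∑-++ : (xs ys : List A) (f : A → ℕ) → ∑ (xs ++ ys) f ≡ ∑ xs f + ∑ ys f
  ∑-++ [] ys f = refl
  ∑-++ (x ∷ xs) ys f = trans (cong (f x +_) (∑-++ xs ys f)) (sym (+-assoc (f x) (∑ xs f) (∑ ys f)))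

  ∑-map : (g : A → B) (xs : List A) (f : B → ℕ) → ∑ (map g xs) f ≡ ∑[ x ← xs ] f (g x)
  ∑-map g [] f = refl
  ∑-map g (x ∷ xs) f = cong (f (g x) +_) (∑-map g xs f)

  ∑-zero : (xs : List A) (f : A → ℕ) → (∀ x → x ∈ xs → f x ≡ 0) → ∑ xs f ≡ 0
  ∑-zero xs f h = trans (∑-cong xs h) (trans (∑-const xs 0) (*-zeroʳ (length xs)))

  ∑-term-≤ : (xs : List A) (f : A → ℕ) {x : A} → x ∈ xs → f x ≤ ∑ xs f
  ∑-term-≤ (y ∷ xs) f (here refl) = m≤m+n (f y) (∑ xs f)
  ∑-term-≤ (y ∷ xs) f (there p) = ≤-trans (∑-term-≤ xs f p) (m≤n+m (∑ xs f) (f y))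

  ∑-delta : (xs : List A) (f : A → ℕ) {y : A} → Unique xs → y ∈ xs → (∀ x → x ≢ y → f x ≡ 0) →
    ∑ xs f ≡ f y
  ∑-delta (x ∷ xs) f (x∉xs ∷ u) (here refl) h =
    trans (cong (f x +_) (∑-zero xs f (λ z z∈xs → h z (λ { refl → Allₚ.All¬⇒¬Any x∉xs z∈xs }))))
          (+-identityʳ (f x))
  ∑-delta (x ∷ xs) f (x∉xs ∷ u) (there y∈xs) h =
    trans (cong (_+ ∑ xs f) (h x λ { refl → Allₚ.All¬⇒¬Any x∉xs y∈xs })) (∑-delta xs f u y∈xs h)

  𝟙 : {P : Set} → Dec P → ℕ
  𝟙 (yes _) = 1
  𝟙 (no _) = 0

  𝟙-yes : (P? : Dec P) → P → 𝟙 P? ≡ 1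
  𝟙-yes (yes _) p = refl
  𝟙-yes (no ¬p) p = ⊥-elim (¬p p)

  𝟙-no : (P? : Dec P) → ¬ P → 𝟙 P? ≡ 0
  𝟙-no (yes p) ¬p = ⊥-elim (¬p p)
  𝟙-no (no _) ¬p = refl

  𝟙≤1 : (P? : Dec P) → 𝟙 P? ≤ 1
  𝟙≤1 (yes _) = s≤s z≤n
  𝟙≤1 (no _) = z≤n

  𝟙-mono : (P? : Dec P) (Q? : Dec Q) → (P → Q) → 𝟙 P? ≤ 𝟙 Q?
  𝟙-mono (yes p) (yes q) f = s≤s z≤n
  𝟙-mono (yes p) (no ¬q) f = ⊥-elim (¬q (f p))
  𝟙-mono (no _) Q? f = z≤n

  𝟙-cong : (P? : Dec P) (Q? : Dec Q) → (P → Q) → (Q → P) → 𝟙 P? ≡ 𝟙 Q?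
  𝟙-cong P? Q? f g = ≤-antisym (𝟙-mono P? Q? f) (𝟙-mono Q? P? g)

  𝟙-⊎ : (P? : Dec P) (Q? : Dec Q) (R? : Dec R) →
    (P → Q ⊎ R) → (Q → P) → (R → P) → (Q → R → ⊥) → 𝟙 P? ≡ 𝟙 Q? + 𝟙 R?
  𝟙-⊎ P? (yes q) (yes r) split fromQ fromR disj = ⊥-elim (disj q r)
  𝟙-⊎ P? (yes q) (no _) split fromQ fromR disj = 𝟙-yes P? (fromQ q)
  𝟙-⊎ P? (no _) (yes r) split fromQ fromR disj = 𝟙-yes P? (fromR r)
  𝟙-⊎ P? (no ¬q) (no ¬r) split fromQ fromR disj =
    𝟙-no P? (λ p → Data.Sum.[ ¬q , ¬r ] (split p))

  𝟙-× : (P? : Dec P) (Q? : Dec Q) → 𝟙 (P? ×-dec Q?) ≡ 𝟙 P? * 𝟙 Q?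
  𝟙-× (yes _) (yes _) = refl
  𝟙-× (yes _) (no _) = refl
  𝟙-× (no _) Q? = refl

  module _ where

    private
      remove : (ys : List A) {x : A} → x ∈ ys → List A
      remove (y ∷ ys) (here _) = ys
      remove (y ∷ ys) (there p) = y ∷ remove ys p

      length-remove : (ys : List A) {x : A} (p : x ∈ ys) → suc (length (remove ys p)) ≡ length ys
      length-remove (y ∷ ys) (here _) = refl
      length-remove (y ∷ ys) (there p) = cong suc (length-remove ys p)

      ∈-remove : (ys : List A) {x z : A} (p : x ∈ ys) → z ∈ ys → x ≢ z → z ∈ remove ys p
      ∈-remove (y ∷ ys) (here refl) (here refl) x≢z = ⊥-elim (x≢z refl)
      ∈-remove (y ∷ ys) (here _) (there q) x≢z = q
      ∈-remove (y ∷ ys) (there p) (here refl) x≢z = here refl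
      ∈-remove (y ∷ ys) (there p) (there q) x≢z = there (∈-remove ys p q x≢z)

    unique-length-≤ : (xs ys : List A) → Unique xs → (∀ z → z ∈ xs → z ∈ ys) → length xs ≤ length ys
    unique-length-≤ [] ys u sub = z≤n
    unique-length-≤ (x ∷ xs) ys (x∉xs ∷ u) sub =
      subst (suc (length xs) ≤_) (length-remove ys x∈ys)
        (s≤s (unique-length-≤ xs (remove ys x∈ys) u
          (λ z z∈xs → ∈-remove ys x∈ys (sub z (there z∈xs)) (λ { refl → Allₚ.All¬⇒¬Any x∉xs z∈xs }))))
      where
      x∈ys = sub x (here refl)

  length-filter : {P : A → Set} (P? : (x : A) → Dec (P x)) (xs : List A) →
    length (filter P? xs) ≡ ∑[ x ← xs ] 𝟙 (P? x)
  length-filter P? [] = refl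
  length-filter P? (x ∷ xs) with P? x
  ... | yes _ = cong suc (length-filter P? xs)
  ... | no _ = length-filter P? xs

  count-by-list : {P : A → Set} (P? : (x : A) → Dec (P x)) (univ ys : List A) →
    Unique univ → Unique ys →
    (∀ z → z ∈ ys → z ∈ univ × P z) → (∀ z → z ∈ univ → P z → z ∈ ys) →
    ∑[ x ← univ ] 𝟙 (P? x) ≡ length ys
  count-by-list P? univ ys u-univ u-ys sound complete = trans (sym (length-filter P? univ))
    (≤-antisym
      (unique-length-≤ _ ys (Unique.filter⁺ P? u-univ)
        (λ z z∈ → let (z∈univ , pz) = ∈-filter⁻ P? z∈ in complete z z∈univ pz))
      (unique-length-≤ ys _ u-ys
        (λ z z∈ys → let (z∈univ , pz) = sound z z∈ys in ∈-filter⁺ P? z∈univ pz)))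

  unique-map : (f : A → B) (xs : List A) → Unique xs →
    (∀ {x y} → x ∈ xs → y ∈ xs → f x ≡ f y → x ≡ y) → Unique (map f xs)
  unique-map f [] [] inj = []
  unique-map f (x ∷ xs) (x∉ ∷ u) inj =
    Allₚ.map⁺ (All.tabulate λ {y} y∈ e → All.lookup x∉ y∈ (inj (here refl) (there y∈) e)) ∷
    unique-map f xs u (λ p q → inj (there p) (there q))

  injection-length-≤ : (f : A → B) (xs : List A) (ys : List B) → Unique xs →
    (∀ {x} → x ∈ xs → f x ∈ ys) → (∀ {x y} → x ∈ xs → y ∈ xs → f x ≡ f y → x ≡ y) → length xs ≤ length ys
  injection-length-≤ f xs ys u into inj = subst (_≤ length ys) (length-map f xs)
    (unique-length-≤ (map f xs) ys (unique-map f xs u inj) (λ z z∈ → let (x , x∈ , z≡) = ∈-map⁻ f z∈ in subst (_∈ ys) (sym z≡) (into x∈)))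

  length-concatMap : (g : A → List B) (xs : List A) → length (concatMap g xs) ≡ ∑[ x ← xs ] length (g x)
  length-concatMap g [] = refl
  length-concatMap g (x ∷ xs) = trans (length-++ (g x)) (cong (length (g x) +_) (length-concatMap g xs))

  concatMap-unique : (g : A → List B) (key : B → A) {xs : List A} → Unique xs →
    (∀ x → Unique (g x)) → (∀ x {z} → z ∈ g x → key z ≡ x) → Unique (concatMap g xs)
  concatMap-unique g key {xs} u-xs u-g keyed = Unique.concat⁺
    (Allₚ.map⁺ (All.tabulate (λ {x} _ → u-g x)))
    (AllPairsₚ.map⁺ (AllPairs.map (λ x≢y {_} (z∈gx , z∈gy) → x≢y (trans (sym (keyed _ z∈gx)) (keyed _ z∈gy))) u-xs))

  length-allFin : (n : ℕ) → length (allFin n) ≡ n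
  length-allFin n = length-tabulate (λ i → i)

  ∑-allFin-suc : (n : ℕ) (f : Fin (suc n) → ℕ) → ∑ (allFin (suc n)) f ≡ f zero + ∑[ x ← allFin n ] f (suc x)
  ∑-allFin-suc n f = cong (f zero +_) (trans (cong (λ xs → ∑ xs f) (sym (map-tabulate (λ i → i) suc))) (∑-map suc (allFin n) f))

  tuples : List A → (d : ℕ) → List (Vec A d)
  tuples xs zero = [] ∷ []
  tuples xs (suc d) = concatMap (λ x → map (x ∷_) (tuples xs d)) xs

  module _ (xs : List A) where

    tuples-unique : (d : ℕ) → Unique xs → Unique (tuples xs d)
    tuples-unique zero u = [] ∷ []
    tuples-unique (suc d) u = concatMap-unique _ Vec.head u
      (λ x → Unique.map⁺ (λ { refl → refl }) (tuples-unique d u))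
      (λ x t∈ → let (_ , _ , t≡) = ∈-map⁻ _ t∈ in cong Vec.head t≡)

    tuples-sound : (d : ℕ) {t : Vec A d} → t ∈ tuples xs d → (i : Fin d) → lookup t i ∈ xs
    tuples-sound (suc d) t∈ i with find (∈-concatMap⁻ _ {xs = xs} t∈)
    ... | x , x∈xs , t∈ʹ with ∈-map⁻ _ t∈ʹ
    tuples-sound (suc d) _ zero | x , x∈xs , _ | _ , _ , refl = x∈xs
    tuples-sound (suc d) _ (suc i) | _ , _ , _ | t , t∈ , refl = tuples-sound d t∈ i

    tuples-complete : (d : ℕ) (t : Vec A d) → ((i : Fin d) → lookup t i ∈ xs) → t ∈ tuples xs d
    tuples-complete zero [] _ = here refl
    tuples-complete (suc d) (x ∷ t) h =
      ∈-concatMap⁺ _ (lose (h zero) (∈-map⁺ (x ∷_) (tuples-complete d t (λ i → h (suc i)))))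

    length-tuples : (d : ℕ) → length (tuples xs d) ≡ length xs ^ d
    length-tuples zero = refl
    length-tuples (suc d) = begin
      length (tuples xs (suc d))                             ≡⟨ length-concatMap _ xs ⟩
      ∑[ x ← xs ] length (map (x ∷_) (tuples xs d))          ≡⟨ ∑-cong xs (λ x _ → length-map (x ∷_) (tuples xs d)) ⟩
      ∑[ _ ← xs ] length (tuples xs d)                       ≡⟨ ∑-const xs _ ⟩
      length xs * length (tuples xs d)                       ≡⟨ cong (length xs *_) (length-tuples d) ⟩
      length xs ^ suc d                                      ∎
      where open ≡-Reasoning

  occ : {k : ℕ} → Bool → Vec Bool k → ℕ
  occ b [] = 0
  occ b (b′ ∷ pc) = 𝟙 (b′ ≟ᵇ b) + occ b pc

  module _ {n : ℕ} {x : Fin n} where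

    ∉⇒All≢ : {k : ℕ} (w : Vec (Fin n) k) → x VMem.∉ w → VAll.All (x ≢_) w
    ∉⇒All≢ [] _ = []
    ∉⇒All≢ (y ∷ w) x∉ = (λ x≡y → x∉ (here x≡y)) ∷ ∉⇒All≢ w (λ p → x∉ (there p))

    All≢⇒∉ : {k : ℕ} {w : Vec (Fin n) k} → VAll.All (x ≢_) w → x VMem.∉ w
    All≢⇒∉ (x≢y ∷ _) (here x≡y) = x≢y x≡y
    All≢⇒∉ (_ ∷ x≢w) (there p) = All≢⇒∉ x≢w p

  -- For a
  -- pattern pc ∈ Bool^k, seqs c pc enumerates the injective w ∈ (Fin n)^k with c (w j) = pc j;
  -- choosing the entries one at a time gives a product of falling factorials.
  module _ {n : ℕ} (c : Fin n → Bool) where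

    size : Bool → ℕ
    size b = ∑[ x ← allFin n ] 𝟙 (c x ≟ᵇ b)

    Fits : {k : ℕ} → Vec Bool k → Vec (Fin n) k → Set
    Fits = Pointwise (λ b y → c y ≡ b)

    Fresh : {k : ℕ} → Bool → Vec (Fin n) k → Fin n → Set
    Fresh b w x = c x ≡ b × x VMem.∉ w

    fresh? : {k : ℕ} (b : Bool) (w : Vec (Fin n) k) (x : Fin n) → Dec (Fresh b w x)
    fresh? b w x = (c x ≟ᵇ b) ×-dec ¬? (VAny.any? (x ≟ᶠ_) w)

    extend : {k : ℕ} → Bool → Vec (Fin n) k → List (Vec (Fin n) (suc k))
    extend b w = map (_∷ w) (filter (fresh? b w) (allFin n))

    seqs : {k : ℕ} → Vec Bool k → List (Vec (Fin n) k)
    seqs [] = [] ∷ []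
    seqs (b ∷ pc) = concatMap (extend b) (seqs pc)

    Used : {k : ℕ} → Bool → Vec (Fin n) k → Fin n → Set
    Used b w x = c x ≡ b × x VMem.∈ w

    used? : {k : ℕ} (b : Bool) (w : Vec (Fin n) k) (x : Fin n) → Dec (Used b w x)
    used? b w x = (c x ≟ᵇ b) ×-dec VAny.any? (x ≟ᶠ_) w

    seqs-unique : {k : ℕ} (pc : Vec Bool k) → Unique (seqs pc)
    seqs-unique [] = [] ∷ []
    seqs-unique (b ∷ pc) = concatMap-unique (extend b) Vec.tail (seqs-unique pc)
      (λ w → Unique.map⁺ (λ { refl → refl }) (Unique.filter⁺ (fresh? b w) (Unique.allFin⁺ n)))
      (λ w z∈ → let (_ , _ , z≡) = ∈-map⁻ _ z∈ in cong Vec.tail z≡)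

    seqs-sound : {k : ℕ} (pc : Vec Bool k) {w : Vec (Fin n) k} → w ∈ seqs pc → VUnique.Unique w × Fits pc w
    seqs-sound [] (here refl) = [] , []
    seqs-sound (b ∷ pc) w∈ with find (∈-concatMap⁻ (extend b) {xs = seqs pc} w∈)
    ... | v , v∈ , w∈ext with ∈-map⁻ _ w∈ext
    ... | x , x∈ , refl with ∈-filter⁻ (fresh? b v) {xs = allFin n} x∈ | seqs-sound pc v∈
    ... | _ , (cx , x∉v) | (uv , fv) = (∉⇒All≢ v x∉v ∷ uv) , (cx ∷ fv)

    seqs-complete : {k : ℕ} (pc : Vec Bool k) {w : Vec (Fin n) k} → VUnique.Unique w → Fits pc w → w ∈ seqs pc
    seqs-complete [] {[]} [] [] = here refl
    seqs-complete (b ∷ pc) {x ∷ w} (x≢w ∷ uw) (cx ∷ fw) =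
      ∈-concatMap⁺ (extend b) (lose (seqs-complete pc uw fw)
        (∈-map⁺ (_∷ w) (∈-filter⁺ (fresh? b w) (∈-allFin x) (cx , All≢⇒∉ x≢w))))

    used-count : (b : Bool) {k : ℕ} {pc : Vec Bool k} {w : Vec (Fin n) k} →
      VUnique.Unique w → Fits pc w → ∑[ x ← allFin n ] 𝟙 (used? b w x) ≡ occ b pc
    used-count b {pc = []} {[]} [] [] = ∑-zero (allFin n) _ (λ x _ → 𝟙-no (used? b [] x) (λ { (_ , ()) }))
    used-count b {pc = b′ ∷ pc} {y ∷ w} (y≢w ∷ uw) (cy ∷ fw) = begin
      ∑[ x ← allFin n ] 𝟙 (used? b (y ∷ w) x)
        ≡⟨ ∑-cong (allFin n) (λ x _ → split x) ⟩
      ∑[ x ← allFin n ] (𝟙 (is-y x) + 𝟙 (used? b w x))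
        ≡⟨ ∑-+ (allFin n) _ _ ⟩
      ∑[ x ← allFin n ] 𝟙 (is-y x) + ∑[ x ← allFin n ] 𝟙 (used? b w x)
        ≡⟨ cong₂ _+_ (∑-delta (allFin n) _ (Unique.allFin⁺ n) (∈-allFin y) (λ x x≢y → 𝟙-no (is-y x) (λ p → x≢y (proj₂ p))))
                     (used-count b uw fw) ⟩
      𝟙 (is-y y) + occ b pc
        ≡⟨ cong (_+ occ b pc) (𝟙-cong (is-y y) (b′ ≟ᵇ b) (λ p → trans (sym cy) (proj₁ p)) (λ b′≡b → trans cy b′≡b , refl)) ⟩
      occ b (b′ ∷ pc) ∎
      where
      open ≡-Reasoning
      is-y : (x : Fin n) → Dec (c x ≡ b × x ≡ y)
      is-y x = (c x ≟ᵇ b) ×-dec (x ≟ᶠ y)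
      split : (x : Fin n) → 𝟙 (used? b (y ∷ w) x) ≡ 𝟙 (is-y x) + 𝟙 (used? b w x)
      split x = 𝟙-⊎ (used? b (y ∷ w) x) (is-y x) (used? b w x)
        (λ { (cx , here e) → inj₁ (cx , e) ; (cx , there p) → inj₂ (cx , p) })
        (λ (cx , e) → cx , here e) (λ (cx , p) → cx , there p)
        (λ { (_ , refl) (_ , p) → All≢⇒∉ y≢w p })

    fresh-count : (b : Bool) {k : ℕ} {pc : Vec Bool k} {w : Vec (Fin n) k} →
      VUnique.Unique w → Fits pc w → ∑[ x ← allFin n ] 𝟙 (fresh? b w x) ≡ size b ∸ occ b pc
    fresh-count b {pc = pc} {w} uw fw = begin
      ∑[ x ← allFin n ] 𝟙 (fresh? b w x)                          ≡⟨ m+n∸n≡m _ (occ b pc) ⟨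
      ∑[ x ← allFin n ] 𝟙 (fresh? b w x) + occ b pc ∸ occ b pc    ≡⟨ cong (λ m → _ + m ∸ occ b pc) (used-count b uw fw) ⟨
      ∑[ x ← allFin n ] 𝟙 (fresh? b w x) + ∑[ x ← allFin n ] 𝟙 (used? b w x) ∸ occ b pc
                                                                  ≡⟨ cong (_∸ occ b pc) (∑-+ (allFin n) _ _) ⟨
      ∑[ x ← allFin n ] (𝟙 (fresh? b w x) + 𝟙 (used? b w x)) ∸ occ b pc
                                                                  ≡⟨ cong (_∸ occ b pc) (∑-cong (allFin n) (λ x _ → split x)) ⟨
      size b ∸ occ b pc                                           ∎
      where
      open ≡-Reasoning
      split : (x : Fin n) → 𝟙 (c x ≟ᵇ b) ≡ 𝟙 (fresh? b w x) + 𝟙 (used? b w x)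
      split x = 𝟙-⊎ (c x ≟ᵇ b) (fresh? b w x) (used? b w x)
        (λ cx → Data.Sum.swap (Data.Sum.map (cx ,_) (cx ,_) (toSum (VAny.any? (x ≟ᶠ_) w))))
        proj₁ proj₁ (λ (_ , x∉w) (_ , x∈w) → x∉w x∈w)

    length-seqs-step : (b : Bool) {k : ℕ} (pc : Vec Bool k) →
      length (seqs (b ∷ pc)) ≡ length (seqs pc) * (size b ∸ occ b pc)
    length-seqs-step b pc = begin
      length (concatMap (extend b) (seqs pc))                  ≡⟨ length-concatMap (extend b) (seqs pc) ⟩
      ∑[ w ← seqs pc ] length (extend b w)                     ≡⟨ ∑-cong (seqs pc) extensions ⟩
      ∑[ w ← seqs pc ] (size b ∸ occ b pc)                     ≡⟨ ∑-const (seqs pc) _ ⟩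
      length (seqs pc) * (size b ∸ occ b pc)                   ∎
      where
      open ≡-Reasoning
      extensions : ∀ w → w ∈ seqs pc → length (extend b w) ≡ size b ∸ occ b pc
      extensions w w∈ = let (uw , fw) = seqs-sound pc w∈ in
        trans (length-map (_∷ w) (filter (fresh? b w) (allFin n))) (trans (length-filter (fresh? b w) (allFin n)) (fresh-count b uw fw))

    length-seqs : {k : ℕ} (pc : Vec Bool k) →
      length (seqs pc) ≡ (size true P′ occ true pc) * (size false P′ occ false pc)
    length-seqs [] = refl
    length-seqs (true ∷ pc) = begin
      length (seqs (true ∷ pc))        ≡⟨ length-seqs-step true pc ⟩
      length (seqs pc) * (T ∸ t)       ≡⟨ cong (_* (T ∸ t)) (length-seqs pc) ⟩
      (T P′ t) * (F P′ f) * (T ∸ t)    ≡⟨ rotate (T P′ t) (F P′ f) (T ∸ t) ⟩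
      (T ∸ t) * (T P′ t) * (F P′ f)    ∎
      where
      open ≡-Reasoning
      T = size true ; F = size false ; t = occ true pc ; f = occ false pc
      rotate : ∀ x y z → x * y * z ≡ z * x * y
      rotate = solve-∀
    length-seqs (false ∷ pc) = begin
      length (seqs (false ∷ pc))       ≡⟨ length-seqs-step false pc ⟩
      length (seqs pc) * (F ∸ f)       ≡⟨ cong (_* (F ∸ f)) (length-seqs pc) ⟩
      (T P′ t) * (F P′ f) * (F ∸ f)    ≡⟨ rotate (T P′ t) (F P′ f) (F ∸ f) ⟩
      (T P′ t) * ((F ∸ f) * (F P′ f))  ∎
      where
      open ≡-Reasoning
      T = size true ; F = size false ; t = occ true pc ; f = occ false pc
      rotate : ∀ x y z → x * y * z ≡ x * (z * y)
      rotate = solve-∀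

  occ-tabulate : {n : ℕ} (c : Fin n → Bool) (b : Bool) → occ b (tabulate c) ≡ size c b
  occ-tabulate {zero} c b = refl
  occ-tabulate {suc n} c b =
    trans (cong (𝟙 (c zero ≟ᵇ b) +_) (occ-tabulate (λ x → c (suc x)) b)) (sym (∑-allFin-suc n _))

  size-lookup : {n : ℕ} (S : Vec Bool n) (b : Bool) → size (lookup S) b ≡ occ b S
  size-lookup S b = trans (sym (occ-tabulate (lookup S) b)) (cong (occ b) (tabulate∘lookup S))

  size-true+false : {n : ℕ} (c : Fin n → Bool) → size c true + size c false ≡ n
  size-true+false {n} c = begin
    size c true + size c false                         ≡⟨ ∑-+ (allFin n) _ _ ⟨
    ∑[ x ← allFin n ] (𝟙 (c x ≟ᵇ true) + 𝟙 (c x ≟ᵇ false)) ≡⟨ ∑-cong (allFin n) (λ x _ → one-colour (c x)) ⟩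
    ∑[ _ ← allFin n ] 1                                ≡⟨ ∑-const (allFin n) 1 ⟩
    length (allFin n) * 1                              ≡⟨ *-identityʳ _ ⟩
    length (allFin n)                                  ≡⟨ length-allFin n ⟩
    n                                                  ∎
    where
    open ≡-Reasoning
    one-colour : (b : Bool) → 𝟙 (b ≟ᵇ true) + 𝟙 (b ≟ᵇ false) ≡ 1
    one-colour true = refl
    one-colour false = refl

  size-false : {n : ℕ} (c : Fin n → Bool) → size c false ≡ n ∸ size c true
  size-false {n} c = trans (sym (m+n∸m≡n (size c true) (size c false))) (cong (_∸ size c true) (size-true+false c))

  size-not : {n : ℕ} (c : Fin n → Bool) → size (not ∘ c) true ≡ size c false
  size-not {n} c = ∑-cong (allFin n) (λ x _ → swap-colour (c x))
    where
    swap-colour : (b : Bool) → 𝟙 (not b ≟ᵇ true) ≡ 𝟙 (b ≟ᵇ false)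
    swap-colour true = refl
    swap-colour false = refl

  module _ {n : ℕ} where

    perm⇒unique : (p : Vec (Fin n) n) → IsPerm p → VUnique.Unique p
    perm⇒unique p inj = subst VUnique.Unique (tabulate∘lookup p) (VUniqueₚ.tabulate⁺ (λ {i} {j} → inj i j))

    Preserves : (Fin n → Bool) → Vec (Fin n) n → Set
    Preserves c p = (j : Fin n) → c (lookup p j) ≡ c j

    preserves? : (c : Fin n → Bool) (p : Vec (Fin n) n) → Dec (Preserves c p)
    preserves? c p = all? (λ j → c (lookup p j) ≟ᵇ c j)

    -- the permutations preserving c: injective tables with the colour pattern of c itself
    preserving : (Fin n → Bool) → List (Vec (Fin n) n)
    preserving c = seqs c (tabulate c)

    preserving-unique : (c : Fin n → Bool) → Unique (preserving c)
    preserving-unique c = seqs-unique c (tabulate c)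

    preserving-sound : (c : Fin n → Bool) {p : Vec (Fin n) n} → p ∈ preserving c → IsPerm p × Preserves c p
    preserving-sound c p∈ = let (u , fits) = seqs-sound c (tabulate c) p∈ in
      VUniqueₚ.lookup-injective u , λ j → trans (Pointwise.lookup fits j) (lookup∘tabulate c j)

    preserving-complete : (c : Fin n → Bool) {p : Vec (Fin n) n} → IsPerm p → Preserves c p → p ∈ preserving c
    preserving-complete c {p} inj pres = seqs-complete c (tabulate c) (perm⇒unique p inj)
      (extensional⇒inductive (ext (λ j → trans (pres j) (sym (lookup∘tabulate c j)))))

    length-preserving : (c : Fin n → Bool) → length (preserving c) ≡ size c true ! * size c false !
    length-preserving c = begin
      length (seqs c (tabulate c))
        ≡⟨ length-seqs c (tabulate c) ⟩
      (size c true P′ occ true (tabulate c)) * (size c false P′ occ false (tabulate c))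
        ≡⟨ cong₂ (λ t f → (size c true P′ t) * (size c false P′ f)) (occ-tabulate c true) (occ-tabulate c false) ⟩
      (size c true P′ size c true) * (size c false P′ size c false)
        ≡⟨ cong₂ _*_ (nP′n≡n! (size c true)) (nP′n≡n! (size c false)) ⟩
      size c true ! * size c false ! ∎
      where open ≡-Reasoning

  module _ {n d : ℕ} where

    Invariant : (Fin n → Bool) → PermTuple n d → Set
    Invariant c σ = (i : Fin d) → Preserves c (lookup σ i)

    invariant? : (c : Fin n → Bool) (σ : PermTuple n d) → Dec (Invariant c σ)
    invariant? c σ = all? (λ i → preserves? c (lookup σ i))

    _∈?_ : (σ : PermTuple n d) (L : List (PermTuple n d)) → Dec (σ ∈ L)
    σ ∈? L = Any.any? (≡-dec (≡-dec _≟ᶠ_) σ) L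

  -- the colouring with a single class, preserved by every permutation
  monochrome : {n : ℕ} → Fin n → Bool
  monochrome _ = true

  perms : (n : ℕ) → List (Vec (Fin n) n)
  perms n = preserving monochrome

  permTuples : (n d : ℕ) → List (PermTuple n d)
  permTuples n d = tuples (perms n) d

  module _ {n d : ℕ} where

    permTuples-unique : Unique (permTuples n d)
    permTuples-unique = tuples-unique (perms n) d (preserving-unique (monochrome {n}))

    permTuples-sound : {σ : PermTuple n d} → σ ∈ permTuples n d → AllPerms σ
    permTuples-sound σ∈ i = proj₁ (preserving-sound monochrome (tuples-sound (perms n) d σ∈ i))

    permTuples-complete : {σ : PermTuple n d} → AllPerms σ → σ ∈ permTuples n d
    permTuples-complete {σ} perm = tuples-complete (perms n) d σ (λ i → preserving-complete monochrome (perm i) (λ _ → refl))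

    length-permTuples : length (permTuples n d) ≡ (n !) ^ d
    length-permTuples = trans (length-tuples (perms n) d) (cong (_^ d) (begin
      length (perms n)                  ≡⟨ length-preserving one ⟩
      size one true ! * size one false !  ≡⟨ cong₂ (λ a b → a ! * b !) all-true none-false ⟩
      n ! * 1                           ≡⟨ *-identityʳ (n !) ⟩
      n !                               ∎))
      where
      open ≡-Reasoning
      one : Fin n → Bool
      one = monochrome
      none-false : size one false ≡ 0
      none-false = ∑-zero (allFin n) _ (λ _ _ → refl)
      all-true : size one true ≡ n
      all-true = trans (sym (+-identityʳ _)) (trans (cong (size one true +_) (sym none-false)) (size-true+false one))

    count-invariant : (c : Fin n → Bool) →
      ∑[ σ ← permTuples n d ] 𝟙 (invariant? c σ) ≡ (size c true ! * size c false !) ^ d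
    count-invariant c = trans
      (count-by-list (invariant? c) (permTuples n d) (tuples (preserving c) d)
        permTuples-unique (tuples-unique (preserving c) d (preserving-unique c))
        (λ σ σ∈ → let pres i = preserving-sound c (tuples-sound (preserving c) d σ∈ i) in
                   permTuples-complete (λ i → proj₁ (pres i)) , (λ i → proj₂ (pres i)))
        (λ σ σ∈ inv → tuples-complete (preserving c) d σ
                        (λ i → preserving-complete c (permTuples-sound σ∈ i) (inv i))))
      (trans (length-tuples (preserving c) d) (cong (_^ d) (length-preserving c)))

    count-members : (L : List (PermTuple n d)) → Unique L → (∀ σ → σ ∈ L → AllPerms σ) →
      ∑[ σ ← permTuples n d ] 𝟙 (σ ∈? L) ≡ length L
    count-members L u perm = count-by-list (_∈? L) (permTuples n d) L permTuples-unique u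
      (λ σ σ∈ → permTuples-complete (perm σ σ∈) , σ∈) (λ _ _ σ∈ → σ∈)

  subsets : (n : ℕ) → List (Vec Bool n)
  subsets n = tuples (true ∷ false ∷ []) n

  subsets-complete : (n : ℕ) (S : Vec Bool n) → S ∈ subsets n
  subsets-complete n S = tuples-complete _ n S (λ i → bool∈ (lookup S i))
    where
    bool∈ : (b : Bool) → b ∈ true ∷ false ∷ []
    bool∈ true = here refl
    bool∈ false = there (here refl)

  ∑-subsets-suc : (n : ℕ) (f : Vec Bool (suc n) → ℕ) →
    ∑ (subsets (suc n)) f ≡ ∑[ S ← subsets n ] f (true ∷ S) + ∑[ S ← subsets n ] f (false ∷ S)
  ∑-subsets-suc n f = begin
    ∑ (map (true ∷_) (subsets n) ++ (map (false ∷_) (subsets n) ++ [])) f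
      ≡⟨ ∑-++ (map (true ∷_) (subsets n)) _ f ⟩
    ∑ (map (true ∷_) (subsets n)) f + ∑ (map (false ∷_) (subsets n) ++ []) f
      ≡⟨ cong₂ _+_ (∑-map (true ∷_) (subsets n) f) (trans (cong (λ xs → ∑ xs f) (++-identityʳ (map (false ∷_) (subsets n)))) (∑-map (false ∷_) (subsets n) f)) ⟩
    ∑[ S ← subsets n ] f (true ∷ S) + ∑[ S ← subsets n ] f (false ∷ S) ∎
    where open ≡-Reasoning

  occ-≤ : {n : ℕ} (S : Vec Bool n) → occ true S ≤ n
  occ-≤ [] = z≤n
  occ-≤ (true ∷ S) = s≤s (occ-≤ S)
  occ-≤ (false ∷ S) = m≤n⇒m≤1+n (occ-≤ S)

  -- the number of subsets of size k satisfies Pascal's rule, hence is n C k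
  count-subsets : (n k : ℕ) → ∑[ S ← subsets n ] 𝟙 (occ true S ≟ k) ≡ n C k
  count-subsets zero zero = refl
  count-subsets zero (suc k) = refl
  count-subsets (suc n) zero = begin
    ∑[ S ← subsets (suc n) ] 𝟙 (occ true S ≟ 0)
      ≡⟨ ∑-subsets-suc n _ ⟩
    ∑[ S ← subsets n ] 𝟙 (suc (occ true S) ≟ 0) + ∑[ S ← subsets n ] 𝟙 (occ true S ≟ 0)
      ≡⟨ cong₂ _+_ (∑-zero (subsets n) _ (λ S _ → 𝟙-no (suc (occ true S) ≟ 0) (λ ()))) (count-subsets n 0) ⟩
    n C 0
      ≡⟨⟩
    suc n C 0 ∎
    where open ≡-Reasoning
  count-subsets (suc n) (suc k) = begin
    ∑[ S ← subsets (suc n) ] 𝟙 (occ true S ≟ suc k)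
      ≡⟨ ∑-subsets-suc n _ ⟩
    ∑[ S ← subsets n ] 𝟙 (suc (occ true S) ≟ suc k) + ∑[ S ← subsets n ] 𝟙 (occ true S ≟ suc k)
      ≡⟨ cong (_+ ∑[ S ← subsets n ] 𝟙 (occ true S ≟ suc k)) (∑-cong (subsets n) (λ S _ → 𝟙-cong (suc (occ true S) ≟ suc k) (occ true S ≟ k) suc-injective (cong suc))) ⟩
    ∑[ S ← subsets n ] 𝟙 (occ true S ≟ k) + ∑[ S ← subsets n ] 𝟙 (occ true S ≟ suc k)
      ≡⟨ cong₂ _+_ (count-subsets n k) (count-subsets n (suc k)) ⟩
    n C k + n C suc k
      ≡⟨ nCk+nC[k+1]≡[n+1]C[k+1] n k ⟩
    suc n C suc k ∎
    where open ≡-Reasoning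

  ∑-subsets-by-size : (n : ℕ) (g : ℕ → ℕ) →
    ∑[ S ← subsets n ] g (occ true S) ≡ ∑[ k ← upTo (suc n) ] ((n C k) * g k)
  ∑-subsets-by-size n g = begin
    ∑[ S ← subsets n ] g (occ true S)
      ≡⟨ ∑-cong (subsets n) (λ S _ → sym (by-delta S)) ⟩
    ∑[ S ← subsets n ] ∑[ k ← upTo (suc n) ] (𝟙 (occ true S ≟ k) * g k)
      ≡⟨ ∑-swap (subsets n) (upTo (suc n)) _ ⟩
    ∑[ k ← upTo (suc n) ] ∑[ S ← subsets n ] (𝟙 (occ true S ≟ k) * g k)
      ≡⟨ ∑-cong (upTo (suc n)) (λ k _ → per-size k) ⟩
    ∑[ k ← upTo (suc n) ] ((n C k) * g k) ∎
    where
    open ≡-Reasoning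
    by-delta : (S : Vec Bool n) → ∑[ k ← upTo (suc n) ] (𝟙 (occ true S ≟ k) * g k) ≡ g (occ true S)
    by-delta S = trans
      (∑-delta (upTo (suc n)) _ (Unique.upTo⁺ (suc n)) (∈-upTo⁺ (s≤s (occ-≤ S)))
        (λ k k≢ → cong (_* g k) (𝟙-no (occ true S ≟ k) (λ e → k≢ (sym e)))))
      (trans (cong (_* g (occ true S)) (𝟙-yes (occ true S ≟ occ true S) refl)) (+-identityʳ _))
    per-size : (k : ℕ) → ∑[ S ← subsets n ] (𝟙 (occ true S ≟ k) * g k) ≡ (n C k) * g k
    per-size k = begin
      ∑[ S ← subsets n ] (𝟙 (occ true S ≟ k) * g k) ≡⟨ ∑-cong (subsets n) (λ S _ → *-comm _ (g k)) ⟩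
      ∑[ S ← subsets n ] (g k * 𝟙 (occ true S ≟ k)) ≡⟨ ∑-*ˡ (subsets n) (g k) _ ⟩
      g k * ∑[ S ← subsets n ] 𝟙 (occ true S ≟ k)   ≡⟨ cong (g k *_) (count-subsets n k) ⟩
      g k * (n C k)                                  ≡⟨ *-comm (g k) (n C k) ⟩
      (n C k) * g k                                 ∎

  nCk*k![n∸k]!≡n! : {n k : ℕ} → k ≤ n → (n C k) * (k ! * (n ∸ k) !) ≡ n !
  nCk*k![n∸k]!≡n! {n} {k} k≤n = trans (cong (_* (k ! * (n ∸ k) !)) (nCk≡n!/k![n-k]! k≤n)) (m/n*n≡m (k![n∸k]!∣n! k≤n))
    where instance _ = k !* (n ∸ k) !≢0

  module _ {n d : ℕ} (σ : PermTuple n d) where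

    adj-sym : {u v : Fin n} → Adj σ u v → Adj σ v u
    adj-sym (i , inj₁ e) = i , inj₂ e
    adj-sym (i , inj₂ e) = i , inj₁ e

    invariant-walk : {c : Fin n → Bool} → Invariant c σ → {u v : Fin n} → Star (Adj σ) u v → c u ≡ c v
    invariant-walk inv ε = refl
    invariant-walk inv ((i , inj₁ refl) ◅ walk) = trans (sym (inv i _)) (invariant-walk inv walk)
    invariant-walk inv ((i , inj₂ refl) ◅ walk) = trans (inv i _) (invariant-walk inv walk)

    invariant⇒disconnected : {c : Fin n → Bool} → Invariant c σ → {u v : Fin n} → c u ≢ c v → ¬ Connected σ
    invariant⇒disconnected inv cu≢cv conn = cu≢cv (invariant-walk inv (conn _ _))

  Small : ℕ → ℕ → Set
  Small n k = 1 ≤ k × 2 * k ≤ n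

  small? : (n k : ℕ) → Dec (Small n k)
  small? n k = (1 ≤? k) ×-dec (2 * k ≤? n)

  ¬¬-decidable : (n : ℕ) (P : Fin n → Set) → ¬ ¬ ((x : Fin n) → Dec (P x))
  ¬¬-decidable zero P k = k (λ ())
  ¬¬-decidable (suc n) P k = ¬¬-decidable n (λ x → P (suc x)) (λ dec-suc →
    ¬¬-excluded-middle (λ dec-zero → k (λ { zero → dec-zero ; (suc x) → dec-suc x })))

  small-side : {n : ℕ} (c : Fin n → Bool) → ¬ (2 * size c true ≤ n) → 2 * size c false ≤ n
  small-side {n} c ≰ with 2 * size c false ≤? n
  ... | yes ≤ = ≤
  ... | no ≰′ = ⊥-elim (<-irrefl refl (begin-strict
    n + n                                <⟨ +-mono-< (≰⇒> ≰) (≰⇒> ≰′) ⟩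
    2 * size c true + 2 * size c false   ≡⟨ *-distribˡ-+ 2 (size c true) (size c false) ⟨
    2 * (size c true + size c false)     ≡⟨ cong (2 *_) (size-true+false c) ⟩
    2 * n                                ≡⟨ cong (n +_) (+-identityʳ n) ⟩
    n + n                                ∎))
    where open ≤-Reasoning

  -- If G(σ) is disconnected, some subset S of size between 1 and n/2 is invariant: the
  -- component of vertex 0 or its complement.  Reachability being decidable only up to double
  -- negation, the conclusion is double-negated; it is used to prove a decidable inequality.
  disconnected⇒small-invariant : {n d : ℕ} (σ : PermTuple (suc n) d) → ¬ Connected σ →
    ¬ ¬ (∃ λ (S : Vec Bool (suc n)) → Small (suc n) (occ true S) × Invariant (lookup S) σ)
  disconnected⇒small-invariant {n} σ disconnected goal = ¬¬-decidable (suc n) Reachable λ reachable? →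
    case-split reachable? (all? reachable?)
    where
    Reachable : Fin (suc n) → Set
    Reachable = Star (Adj σ) zero
    case-split : ((x : Fin (suc n)) → Dec (Reachable x)) → Dec (∀ x → Reachable x) → ⊥
    case-split reachable? (yes all-reachable) =
      disconnected (λ u v → reverse (adj-sym σ) (all-reachable u) ◅◅ all-reachable v)
    case-split reachable? (no not-all) = goal (choose (2 * size C₀ true ≤? suc n))
      where
      C₀ : Fin (suc n) → Bool
      C₀ x = does (reachable? x)
      C₀-invariant : Invariant C₀ σ
      C₀-invariant i j = does-⇔ (mk⇔ (λ r → r ◅◅ (adj-sym σ (i , inj₁ refl) ◅ ε)) (λ r → r ◅◅ ((i , inj₁ refl) ◅ ε)))
        (reachable? _) (reachable? j)
      some-true : 1 ≤ size C₀ true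
      some-true = ≤-trans (≤-reflexive (sym (𝟙-yes (C₀ zero ≟ᵇ true) (dec-true (reachable? zero) ε))))
                          (∑-term-≤ (allFin (suc n)) _ (∈-allFin zero))
      some-false : 1 ≤ size C₀ false
      some-false with ¬∀⟶∃¬ (suc n) Reachable reachable? not-all
      ... | y , unreachable = ≤-trans (≤-reflexive (sym (𝟙-yes (C₀ y ≟ᵇ false) (dec-false (reachable? y) unreachable))))
                                      (∑-term-≤ (allFin (suc n)) _ (∈-allFin y))
      choose : Dec (2 * size C₀ true ≤ suc n) →
        ∃ λ (S : Vec Bool (suc n)) → Small (suc n) (occ true S) × Invariant (lookup S) σ
      choose (yes small) = tabulate C₀ ,
        subst (Small (suc n)) (sym (occ-tabulate C₀ true)) (some-true , small) ,
        (λ i j → trans (lookup∘tabulate C₀ _) (trans (C₀-invariant i j) (sym (lookup∘tabulate C₀ j))))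
      choose (no large) = tabulate (not ∘ C₀) ,
        subst (Small (suc n)) (sym (trans (occ-tabulate (not ∘ C₀) true) (size-not C₀)))
          (some-false , small-side C₀ large) ,
        (λ i j → trans (lookup∘tabulate (not ∘ C₀) _) (trans (cong not (C₀-invariant i j)) (sym (lookup∘tabulate (not ∘ C₀) j))))

  count-invariant-subset : {n d : ℕ} (S : Vec Bool n) →
    ∑[ σ ← permTuples n d ] 𝟙 (invariant? (lookup S) σ) ≡ (occ true S ! * (n ∸ occ true S) !) ^ d
  count-invariant-subset {n} {d} S = trans (count-invariant {n} {d} (lookup S))
    (cong₂ (λ a b → (a ! * b !) ^ d) (size-lookup S true)
      (trans (size-false (lookup S)) (cong (n ∸_) (size-lookup S true))))

  smallWeight : ℕ → ℕ → ℕ → ℕ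
  smallWeight n d k = 𝟙 (small? n k) * (k ! * (n ∸ k) !) ^ d

  -- Lower bound.  Every tuple outside L leaves a small subset invariant, so summing over all
  -- tuples,  (n!)^d ≤ |L| + ∑_{k small} (n C k) (k! (n−k)!)^d.
  module LowerBound {n d : ℕ} (L : List (PermTuple (suc n) d)) (L-unique : Unique L)
                    (L-spec : (σ : PermTuple (suc n) d) → σ ∈ L ⇔ (AllPerms σ × Connected σ)) where

    smallInvariant : PermTuple (suc n) d → ℕ
    smallInvariant σ = ∑[ S ← subsets (suc n) ] (𝟙 (small? (suc n) (occ true S)) * 𝟙 (invariant? (lookup S) σ))

    in-L-or-small-invariant : (σ : PermTuple (suc n) d) → σ ∈ permTuples (suc n) d → 1 ≤ 𝟙 (σ ∈? L) + smallInvariant σ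
    in-L-or-small-invariant σ σ∈ with σ ∈? L
    ... | yes _ = s≤s z≤n
    ... | no σ∉L = decidable-stable (1 ≤? smallInvariant σ) λ none →
      disconnected⇒small-invariant σ (λ conn → σ∉L (Equivalence.from (L-spec σ) (permTuples-sound σ∈ , conn)))
        λ (S , small , inv) → none (≤-trans
          (≤-reflexive (sym (cong₂ _*_ (𝟙-yes (small? (suc n) _) small) (𝟙-yes (invariant? (lookup S) σ) inv))))
          (∑-term-≤ (subsets (suc n)) _ (subsets-complete (suc n) S)))

    ∑-smallInvariant : ∑[ σ ← permTuples (suc n) d ] smallInvariant σ ≡ ∑[ k ← upTo (suc (suc n)) ] ((suc n C k) * smallWeight (suc n) d k)
    ∑-smallInvariant = begin
      ∑[ σ ← permTuples (suc n) d ] smallInvariant σ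
        ≡⟨ ∑-swap (permTuples (suc n) d) (subsets (suc n)) _ ⟩
      ∑[ S ← subsets (suc n) ] ∑[ σ ← permTuples (suc n) d ] (𝟙 (small? (suc n) (occ true S)) * 𝟙 (invariant? (lookup S) σ))
        ≡⟨ ∑-cong (subsets (suc n)) (λ S _ → trans (∑-*ˡ (permTuples (suc n) d) (𝟙 (small? (suc n) (occ true S))) (λ σ → 𝟙 (invariant? (lookup S) σ)))
             (cong (𝟙 (small? (suc n) (occ true S)) *_) (count-invariant-subset {d = d} S))) ⟩
      ∑[ S ← subsets (suc n) ] smallWeight (suc n) d (occ true S)
        ≡⟨ ∑-subsets-by-size (suc n) (smallWeight (suc n) d) ⟩
      ∑[ k ← upTo (suc (suc n)) ] ((suc n C k) * smallWeight (suc n) d k) ∎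
      where open ≡-Reasoning

    lower-bound : (suc n !) ^ d ≤ length L + ∑[ k ← upTo (suc (suc n)) ] ((suc n C k) * smallWeight (suc n) d k)
    lower-bound = begin
      (suc n !) ^ d                                     ≡⟨ length-permTuples {suc n} {d} ⟨
      length (permTuples (suc n) d)                     ≡⟨ trans (∑-const (permTuples (suc n) d) 1) (*-identityʳ _) ⟨
      ∑[ σ ← permTuples (suc n) d ] 1                   ≤⟨ ∑-mono (permTuples (suc n) d) in-L-or-small-invariant ⟩
      ∑[ σ ← permTuples (suc n) d ] (𝟙 (σ ∈? L) + smallInvariant σ)
                                                        ≡⟨ ∑-+ (permTuples (suc n) d) _ _ ⟩
      ∑[ σ ← permTuples (suc n) d ] 𝟙 (σ ∈? L) + ∑[ σ ← permTuples (suc n) d ] smallInvariant σ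
                                                        ≡⟨ cong₂ _+_ (count-members L L-unique (λ σ σ∈ → proj₁ (Equivalence.to (L-spec σ) σ∈))) ∑-smallInvariant ⟩
      length L + ∑[ k ← upTo (suc (suc n)) ] ((suc n C k) * smallWeight (suc n) d k) ∎
      where open ≤-Reasoning

  module _ {n : ℕ} where

    point : Fin n → Fin n → Bool
    point v x = does (x ≟ᶠ v)

    pair : Fin n → Fin n → Fin n → Bool
    pair u v x = point u x ∨ point v x

    point-true : {v x : Fin n} → point v x ≡ true → x ≡ v
    point-true {v} {x} with x ≟ᶠ v
    ... | yes x≡v = λ _ → x≡v
    ... | no _ = λ ()

    𝟙-point : (v x : Fin n) → 𝟙 (point v x ≟ᵇ true) ≡ 𝟙 (x ≟ᶠ v)
    𝟙-point v x = 𝟙-cong (point v x ≟ᵇ true) (x ≟ᶠ v) point-true (λ x≡v → dec-true (x ≟ᶠ v) x≡v)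

    size-point : (v : Fin n) → size (point v) true ≡ 1
    size-point v = trans (∑-cong (allFin n) (λ x _ → 𝟙-point v x))
      (trans (∑-delta (allFin n) _ (Unique.allFin⁺ n) (∈-allFin v) (λ x → 𝟙-no (x ≟ᶠ v))) (𝟙-yes (v ≟ᶠ v) refl))

    size-pair : {u v : Fin n} → u ≢ v → size (pair u v) true ≡ 2
    size-pair {u} {v} u≢v = begin
      size (pair u v) true                                            ≡⟨ ∑-cong (allFin n) (λ x _ → split x) ⟩
      ∑[ x ← allFin n ] (𝟙 (point u x ≟ᵇ true) + 𝟙 (point v x ≟ᵇ true)) ≡⟨ ∑-+ (allFin n) _ _ ⟩
      size (point u) true + size (point v) true                       ≡⟨ cong₂ _+_ (size-point u) (size-point v) ⟩
      2                                                               ∎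
      where
      open ≡-Reasoning
      split : (x : Fin n) → 𝟙 (pair u v x ≟ᵇ true) ≡ 𝟙 (point u x ≟ᵇ true) + 𝟙 (point v x ≟ᵇ true)
      split x = 𝟙-⊎ (pair u v x ≟ᵇ true) (point u x ≟ᵇ true) (point v x ≟ᵇ true)
        (λ e → Data.Sum.map id id (∨-true (point u x) e))
        (λ e → cong (_∨ point v x) e) (λ e → trans (cong (point u x ∨_) e) (∨-zeroʳ (point u x)))
        (λ eu ev → u≢v (trans (sym (point-true {u} {x} eu)) (point-true {v} {x} ev)))
        where
        ∨-true : (a : Bool) {b : Bool} → (a ∨ b) ≡ true → a ≡ true ⊎ b ≡ true
        ∨-true true _ = inj₁ refl
        ∨-true false e = inj₂ e

    pair-invariant : {d : ℕ} {σ : PermTuple n d} (u v : Fin n) →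
      Invariant (point u) σ → Invariant (point v) σ → Invariant (pair u v) σ
    pair-invariant u v fix-u fix-v i j = cong₂ _∨_ (fix-u i j) (fix-v i j)

  -- A connected tuple fixes no point (n ≥ 2): point v would be an invariant colouring taking both values.
  connected⇒no-fixed-point : {n d : ℕ} (σ : PermTuple (suc (suc n)) d) → Connected σ →
    (v : Fin (suc (suc n))) → ¬ Invariant (point v) σ
  connected⇒no-fixed-point σ conn v fixed = invariant⇒disconnected σ fixed {v} {other v} distinct conn
    where
    other : {m : ℕ} → Fin (suc (suc m)) → Fin (suc (suc m))
    other zero = suc zero
    other (suc _) = zero
    distinct : point v v ≢ point v (other v)
    distinct e = other-≢ v (sym (point-true (trans (sym e) (dec-true (v ≟ᶠ v) refl))))
      where
      other-≢ : {m : ℕ} (w : Fin (suc (suc m))) → w ≢ other w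
      other-≢ zero ()
      other-≢ (suc w) ()

  -- With N = n + 2 points, a tuple in L fixes no point, and any tuple
  -- fixing some point u₀ fixes every other fixed point u together with u₀; hence
  -- 𝟙(σ ∈ L) + #fixed points ≤ 1 + #fixed ordered pairs, and summing over all tuples,
  -- |L| + N ((N−1)!)^d ≤ (N!)^d + N² (2 (N−2)!)^d.
  module UpperBound {n d : ℕ} (L : List (PermTuple (suc (suc n)) d)) (L-unique : Unique L)
                    (L-spec : (σ : PermTuple (suc (suc n)) d) → σ ∈ L ⇔ (AllPerms σ × Connected σ)) where

    private
      N : ℕ
      N = suc (suc n)

    fixedPoints : PermTuple N d → ℕ
    fixedPoints σ = ∑[ v ← allFin N ] 𝟙 (invariant? (point v) σ)

    pairTerm : Fin N → Fin N → PermTuple N d → ℕ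
    pairTerm u v σ = 𝟙 (¬? (u ≟ᶠ v)) * 𝟙 (invariant? (pair u v) σ)

    fixedPairs : PermTuple N d → ℕ
    fixedPairs σ = ∑[ u ← allFin N ] ∑[ v ← allFin N ] pairTerm u v σ

    -- if some point u₀ is fixed, every other fixed point u gives the invariant pair {u, u₀}
    fixedPoints≤ : (σ : PermTuple N d) → Dec (∃ λ u₀ → Invariant (point u₀) σ) → fixedPoints σ ≤ 1 + fixedPairs σ
    fixedPoints≤ σ (no none) = ≤-trans (≤-reflexive (∑-zero (allFin N) _ λ v _ → 𝟙-no (invariant? (point v) σ) (λ fix → none (v , fix)))) z≤n
    fixedPoints≤ σ (yes (u₀ , fix-u₀)) = begin
      fixedPoints σ                                                   ≤⟨ ∑-mono (allFin N) (λ u _ → per-point u) ⟩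
      ∑[ u ← allFin N ] (𝟙 (u ≟ᶠ u₀) + pairsAt u)                       ≡⟨ ∑-+ (allFin N) (λ u → 𝟙 (u ≟ᶠ u₀)) pairsAt ⟩
      ∑[ u ← allFin N ] 𝟙 (u ≟ᶠ u₀) + fixedPairs σ                      ≡⟨ cong (_+ fixedPairs σ) just-u₀ ⟩
      1 + fixedPairs σ                                                ∎
      where
      open ≤-Reasoning
      pairsAt : Fin N → ℕ
      pairsAt u = ∑[ v ← allFin N ] pairTerm u v σ
      just-u₀ : ∑[ u ← allFin N ] 𝟙 (u ≟ᶠ u₀) ≡ 1
      just-u₀ = trans (∑-delta (allFin N) _ (Unique.allFin⁺ N) (∈-allFin u₀) (λ u → 𝟙-no (u ≟ᶠ u₀))) (𝟙-yes (u₀ ≟ᶠ u₀) refl)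
      per-point : (u : Fin N) → 𝟙 (invariant? (point u) σ) ≤ 𝟙 (u ≟ᶠ u₀) + pairsAt u
      per-point u with u ≟ᶠ u₀
      ... | yes _ = ≤-trans (𝟙≤1 (invariant? (point u) σ)) (m≤m+n 1 _)
      ... | no u≢u₀ = ≤-trans (𝟙-mono (invariant? (point u) σ) (¬? (u ≟ᶠ u₀) ×-dec invariant? (pair u u₀) σ)
                                      (λ fix-u → u≢u₀ , pair-invariant {σ = σ} u u₀ fix-u fix-u₀))
                     (≤-trans (≤-reflexive (𝟙-× (¬? (u ≟ᶠ u₀)) (invariant? (pair u u₀) σ)))
                       (∑-term-≤ (allFin N) (λ v → pairTerm u v σ) (∈-allFin u₀)))

    bonferroni : (σ : PermTuple N d) → 𝟙 (σ ∈? L) + fixedPoints σ ≤ 1 + fixedPairs σ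
    bonferroni σ with σ ∈? L
    ... | yes σ∈L = s≤s (≤-trans (≤-reflexive (∑-zero (allFin N) _ λ v _ →
                      𝟙-no (invariant? (point v) σ) (connected⇒no-fixed-point σ (proj₂ (Equivalence.to (L-spec σ) σ∈L)) v))) z≤n)
    ... | no _ = fixedPoints≤ σ (any? (λ u → invariant? (point u) σ))

    ∑-fixedPoints : ∑[ σ ← permTuples N d ] fixedPoints σ ≡ N * (suc n !) ^ d
    ∑-fixedPoints = begin
      ∑[ σ ← permTuples N d ] fixedPoints σ                     ≡⟨ ∑-swap (permTuples N d) (allFin N) _ ⟩
      ∑[ v ← allFin N ] ∑[ σ ← permTuples N d ] 𝟙 (invariant? (point v) σ)
                                                                ≡⟨ ∑-cong (allFin N) (λ v _ → count-fixing v) ⟩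
      ∑[ v ← allFin N ] ((suc n !) ^ d)                         ≡⟨ ∑-const (allFin N) ((suc n !) ^ d) ⟩
      length (allFin N) * (suc n !) ^ d                         ≡⟨ cong (_* (suc n !) ^ d) (length-allFin N) ⟩
      N * (suc n !) ^ d                                         ∎
      where
      open ≡-Reasoning
      count-fixing : (v : Fin N) → ∑[ σ ← permTuples N d ] 𝟙 (invariant? (point v) σ) ≡ (suc n !) ^ d
      count-fixing v = trans (count-invariant {N} {d} (point v)) (cong (_^ d) (begin
        size (point v) true ! * size (point v) false !   ≡⟨ cong (λ m → m ! * size (point v) false !) (size-point v) ⟩
        1 * size (point v) false !                         ≡⟨ *-identityˡ _ ⟩
        size (point v) false !                             ≡⟨ cong _! (trans (size-false (point v)) (cong (N ∸_) (size-point v))) ⟩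
        suc n !                                            ∎))

    ∑-fixedPairs : ∑[ σ ← permTuples N d ] fixedPairs σ ≤ N * (N * (2 * n !) ^ d)
    ∑-fixedPairs = begin
      ∑[ σ ← permTuples N d ] fixedPairs σ
        ≡⟨ ∑-swap (permTuples N d) (allFin N) _ ⟩
      ∑[ u ← allFin N ] ∑[ σ ← permTuples N d ] ∑[ v ← allFin N ] pairTerm u v σ
        ≡⟨ ∑-cong (allFin N) (λ u _ → ∑-swap (permTuples N d) (allFin N) (λ σ v → pairTerm u v σ)) ⟩
      ∑[ u ← allFin N ] ∑[ v ← allFin N ] ∑[ σ ← permTuples N d ] pairTerm u v σ
        ≤⟨ ∑-mono (allFin N) (λ u _ → ∑-mono (allFin N) (λ v _ → count-pair u v)) ⟩
      ∑[ u ← allFin N ] ∑[ v ← allFin N ] ((2 * n !) ^ d)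
        ≡⟨ ∑-cong (allFin N) (λ u _ → trans (∑-const (allFin N) ((2 * n !) ^ d)) (cong (_* (2 * n !) ^ d) (length-allFin N))) ⟩
      ∑[ u ← allFin N ] (N * (2 * n !) ^ d)
        ≡⟨ trans (∑-const (allFin N) (N * (2 * n !) ^ d)) (cong (_* (N * (2 * n !) ^ d)) (length-allFin N)) ⟩
      N * (N * (2 * n !) ^ d) ∎
      where
      open ≤-Reasoning
      count-pair : (u v : Fin N) → ∑[ σ ← permTuples N d ] pairTerm u v σ ≤ (2 * n !) ^ d
      count-pair u v with u ≟ᶠ v
      ... | yes _ = ≤-trans (≤-reflexive (∑-zero (permTuples N d) _ (λ _ _ → refl))) z≤n
      ... | no u≢v = ≤-reflexive (begin-equality
        ∑[ σ ← permTuples N d ] (1 * 𝟙 (invariant? (pair u v) σ))  ≡⟨ ∑-cong (permTuples N d) (λ σ _ → *-identityˡ _) ⟩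
        ∑[ σ ← permTuples N d ] 𝟙 (invariant? (pair u v) σ)        ≡⟨ count-invariant {N} {d} (pair u v) ⟩
        (size (pair u v) true ! * size (pair u v) false !) ^ d     ≡⟨ cong₂ (λ a b → (a ! * b !) ^ d) (size-pair u≢v)
                                                                        (trans (size-false (pair u v)) (cong (N ∸_) (size-pair u≢v))) ⟩
        (2 * n !) ^ d                                              ∎)

    upper-bound : length L + N * (suc n !) ^ d ≤ (N !) ^ d + N * (N * (2 * n !) ^ d)
    upper-bound = begin
      length L + N * (suc n !) ^ d
        ≡⟨ cong₂ _+_ (count-members L L-unique (λ σ σ∈ → proj₁ (Equivalence.to (L-spec σ) σ∈))) ∑-fixedPoints ⟨
      ∑[ σ ← permTuples N d ] 𝟙 (σ ∈? L) + ∑[ σ ← permTuples N d ] fixedPoints σ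
        ≡⟨ ∑-+ (permTuples N d) _ _ ⟨
      ∑[ σ ← permTuples N d ] (𝟙 (σ ∈? L) + fixedPoints σ)
        ≤⟨ ∑-mono (permTuples N d) (λ σ _ → bonferroni σ) ⟩
      ∑[ σ ← permTuples N d ] (1 + fixedPairs σ)
        ≡⟨ ∑-+ (permTuples N d) _ _ ⟩
      ∑[ σ ← permTuples N d ] 1 + ∑[ σ ← permTuples N d ] fixedPairs σ
        ≤⟨ +-mono-≤ (≤-reflexive (trans (∑-const (permTuples N d) 1) (trans (*-identityʳ _) (length-permTuples {N} {d})))) ∑-fixedPairs ⟩
      (N !) ^ d + N * (N * (2 * n !) ^ d) ∎
      where open ≤-Reasoning

  iter : (A → A) → ℕ → A → A
  iter f zero x = x
  iter f (suc k) x = f (iter f k x)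

  module Orbit {n : ℕ} (p : Fin n → Fin n) (p-injective : (x y : Fin n) → p x ≡ p y → x ≡ y) where

    iter-+ : (k t : ℕ) (x : Fin n) → iter p (k + t) x ≡ iter p k (iter p t x)
    iter-+ zero t x = refl
    iter-+ (suc k) t x = cong p (iter-+ k t x)

    iter-injective : (k : ℕ) {x y : Fin n} → iter p k x ≡ iter p k y → x ≡ y
    iter-injective zero e = e
    iter-injective (suc k) e = iter-injective k (p-injective _ _ e)

    repetition⇒period : (x : Fin n) {i j : ℕ} → i ≤ j → iter p i x ≡ iter p j x → iter p (j ∸ i) x ≡ x
    repetition⇒period x {i} {j} i≤j e = sym (iter-injective i (begin
      iter p i x                    ≡⟨ e ⟩
      iter p j x                    ≡⟨ cong (λ k → iter p k x) (m+[n∸m]≡n i≤j) ⟨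
      iter p (i + (j ∸ i)) x        ≡⟨ iter-+ i (j ∸ i) x ⟩
      iter p i (iter p (j ∸ i) x)   ∎))
      where open ≡-Reasoning

    -- some period between 1 and n exists, by pigeonhole on x, p x, …, pⁿ x
    period : (x : Fin n) → ∃ λ P → 1 ≤ P × P ≤ n × iter p P x ≡ x
    period x with pigeonhole (n<1+n n) (λ (k : Fin (suc n)) → iter p (toℕ k) x)
    ... | i , j , i<j , e = toℕ j ∸ toℕ i , m<n⇒0<n∸m i<j , ≤-trans (m∸n≤m (toℕ j) (toℕ i)) (≤-pred (toℕ<n j)) ,
                            repetition⇒period x (<⇒≤ i<j) e

    InOrbit : ℕ → Fin n → Fin n → Set
    InOrbit P x y = ∃ λ k → k < P × iter p k x ≡ y

    orbit-forward : {P : ℕ} {x y : Fin n} → iter p P x ≡ x → InOrbit P x y → InOrbit P x (p y)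
    orbit-forward {P} per (k , k<P , refl) with suc k <? P
    ... | yes k+1<P = suc k , k+1<P , refl
    ... | no k+1≮P = 0 , ≤-trans (s≤s z≤n) k<P , trans (sym per) (cong (λ j → iter p j _) (≤-antisym (≮⇒≥ k+1≮P) k<P))

    orbit-backward : {P : ℕ} {x y : Fin n} → iter p P x ≡ x → InOrbit P x (p y) → InOrbit P x y
    orbit-backward per (suc k , k+1<P , e) = k , <-trans (n<1+n k) k+1<P , p-injective _ _ e
    orbit-backward {suc P} per (zero , _ , e) = P , n<1+n P , p-injective _ _ (trans per e)

    covering-orbit : {P : ℕ} {x : Fin n} → (∀ y → InOrbit P x y) → n ≤ P
    covering-orbit {P} {x} cover = injective⇒≤ {f = index} λ {y} {y′} e →
      trans (sym (proj₂ (proj₂ (cover y)))) (trans (cong (λ k → iter p k x)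
        (trans (sym (toℕ-fromℕ< _)) (trans (cong toℕ e) (toℕ-fromℕ< _)))) (proj₂ (proj₂ (cover y′))))
      where
      index : Fin n → Fin P
      index y = fromℕ< (proj₁ (proj₂ (cover y)))

  -- The case d = 1.  If G(σ) is connected, the orbit of 0 under its permutation p covers all
  -- n points, so 0, p 0, …, pⁿ⁻¹ 0 are distinct and pⁿ 0 = 0.  Hence σ is determined by the
  -- injective sequence (p 0, …, pⁿ⁻¹ 0) avoiding 0, and there are at most (n−1)! such σ.
  orbit : {m : ℕ} → PermTuple (suc m) 1 → Vec (Fin (suc m)) m
  orbit σ = tabulate (λ i → iter (lookup (lookup σ zero)) (suc (toℕ i)) zero)

  module Cycle {m : ℕ} (σ : PermTuple (suc m) 1) (perm : AllPerms σ) (conn : Connected σ) where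

    p : Fin (suc m) → Fin (suc m)
    p = lookup (lookup σ zero)

    open Orbit p (perm zero)

    walk-in-orbit : {P : ℕ} → iter p P zero ≡ zero →
      {a b : Fin (suc m)} → Star (Adj σ) a b → InOrbit P zero a → InOrbit P zero b
    walk-in-orbit per ε o = o
    walk-in-orbit per ((zero , inj₁ refl) ◅ walk) o = walk-in-orbit per walk (orbit-forward per o)
    walk-in-orbit per ((zero , inj₂ refl) ◅ walk) o = walk-in-orbit per walk (orbit-backward per o)

    period-≥ : {P : ℕ} → 1 ≤ P → iter p P zero ≡ zero → suc m ≤ P
    period-≥ 1≤P per = covering-orbit (λ y → walk-in-orbit per (conn zero y) (0 , 1≤P , refl))

    period-n : iter p (suc m) zero ≡ zero
    period-n with period zero
    ... | P , 1≤P , P≤n , per = subst (λ k → iter p k zero ≡ zero) (≤-antisym P≤n (period-≥ 1≤P per)) per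

    covers : (y : Fin (suc m)) → InOrbit (suc m) zero y
    covers y = walk-in-orbit period-n (conn zero y) (0 , s≤s z≤n , refl)

    distinct : {i j : ℕ} → i < j → j < suc m → iter p i zero ≢ iter p j zero
    distinct {i} {j} i<j j<n e = <⇒≱ (≤-trans (s≤s (m∸n≤m j i)) j<n)
      (period-≥ (m<n⇒0<n∸m i<j) (repetition⇒period zero (<⇒≤ i<j) e))

    lookup-orbit : {k : ℕ} (k<m : k < m) → lookup (orbit σ) (fromℕ< k<m) ≡ iter p (suc k) zero
    lookup-orbit {k} k<m = trans (lookup∘tabulate _ (fromℕ< k<m)) (cong (λ j → iter p (suc j) zero) (toℕ-fromℕ< k<m))

    orbit-unique : VUnique.Unique (orbit σ)
    orbit-unique = VUniqueₚ.tabulate⁺ λ {i} {j} e → toℕ-injective (suc-injective (injective-below (s≤s (toℕ<n i)) (s≤s (toℕ<n j)) e))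
      where
      injective-below : {i j : ℕ} → i < suc m → j < suc m → iter p i zero ≡ iter p j zero → i ≡ j
      injective-below {i} {j} i<n j<n e with <-cmp i j
      ... | tri< i<j _ _ = ⊥-elim (distinct i<j j<n e)
      ... | tri≈ _ i≡j _ = i≡j
      ... | tri> _ _ j<i = ⊥-elim (distinct j<i i<n (sym e))

    orbit-avoids-0 : Fits (point zero) (Vec.replicate m false) (orbit σ)
    orbit-avoids-0 = extensional⇒inductive (ext λ j → trans
      (cong (point zero) (lookup∘tabulate _ j))
      (trans (dec-false (_ ≟ᶠ zero) (λ e → distinct (s≤s z≤n) (s≤s (toℕ<n j)) (sym e)))
             (sym (lookup-replicate j false))))

    orbit-∈ : orbit σ ∈ seqs (point zero) (Vec.replicate m false)
    orbit-∈ = seqs-complete (point zero) _ orbit-unique orbit-avoids-0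

  orbit-determines : {m : ℕ} (σ τ : PermTuple (suc m) 1) → AllPerms σ × Connected σ → AllPerms τ × Connected τ →
    orbit σ ≡ orbit τ → σ ≡ τ
  orbit-determines {m} σ@(s ∷ []) τ@(t ∷ []) (perm-σ , conn-σ) (perm-τ , conn-τ) same = cong (_∷ []) (begin
    s                      ≡⟨ tabulate∘lookup s ⟨
    tabulate (lookup s)    ≡⟨ tabulate-cong same-map ⟩
    tabulate (lookup t)    ≡⟨ tabulate∘lookup t ⟩
    t                      ∎)
    where
    open ≡-Reasoning
    module Cσ = Cycle σ perm-σ conn-σ
    module Cτ = Cycle τ perm-τ conn-τ
    same-iterates : {k : ℕ} → k ≤ m → iter (lookup s) k zero ≡ iter (lookup t) k zero
    same-iterates {zero} _ = refl
    same-iterates {suc k} k<m = trans (sym (Cσ.lookup-orbit k<m)) (trans (cong (λ v → lookup v (fromℕ< k<m)) same) (Cτ.lookup-orbit k<m))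
    same-map : (x : Fin (suc m)) → lookup s x ≡ lookup t x
    same-map x with Cσ.covers x
    ... | k , k<n , refl with m≤n⇒m<n∨m≡n (≤-pred k<n)
    ...   | inj₁ k<m = trans (same-iterates k<m) (cong (lookup t) (sym (same-iterates (<⇒≤ k<m))))
    ...   | inj₂ refl = trans Cσ.period-n (trans (sym Cτ.period-n) (cong (lookup t) (sym (same-iterates ≤-refl))))

  occ-replicate : (b : Bool) (m : ℕ) → occ b (Vec.replicate m false) ≡ m * 𝟙 (false ≟ᵇ b)
  occ-replicate b zero = refl
  occ-replicate b (suc m) = cong (𝟙 (false ≟ᵇ b) +_) (occ-replicate b m)

  cycle-bound : {m : ℕ} (L : List (PermTuple (suc m) 1)) → Unique L →
    ((σ : PermTuple (suc m) 1) → σ ∈ L ⇔ (AllPerms σ × Connected σ)) → length L ≤ m !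
  cycle-bound {m} L L-unique L-spec = begin
    length L
      ≤⟨ injection-length-≤ orbit L _ L-unique (λ {σ} σ∈ → let (perm , conn) = Equivalence.to (L-spec σ) σ∈ in Cycle.orbit-∈ σ perm conn)
           (λ {σ} {τ} σ∈ τ∈ → orbit-determines σ τ (Equivalence.to (L-spec σ) σ∈) (Equivalence.to (L-spec τ) τ∈)) ⟩
    length (seqs c₀ (Vec.replicate m false))
      ≡⟨ length-seqs c₀ (Vec.replicate m false) ⟩
    (size c₀ true P′ occ true (Vec.replicate m false)) * (size c₀ false P′ occ false (Vec.replicate m false))
      ≡⟨ cong₂ (λ a b → (size c₀ true P′ a) * (size c₀ false P′ b))
           (trans (occ-replicate true m) (*-zeroʳ m)) (trans (occ-replicate false m) (*-identityʳ m)) ⟩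
    (size c₀ true P′ 0) * (size c₀ false P′ m)
      ≡⟨ cong (λ k → 1 * (k P′ m)) (trans (size-false c₀) (cong (suc m ∸_) (size-point {suc m} zero))) ⟩
    1 * (m P′ m)
      ≡⟨ trans (*-identityˡ _) (nP′n≡n! m) ⟩
    m ! ∎
    where
    open ≤-Reasoning
    c₀ : Fin (suc m) → Bool
    c₀ = point zero

  private
    double-suc : ∀ k → suc (k + suc k) ≡ 2 * suc k
    double-suc = solve-∀
    square-bound : ∀ r → (3 + r) * (3 + r) + (3 * r * r + 10 * r + 7) ≡ 4 * ((2 + r) * (2 + r))
    square-bound = solve-∀
    second-size : ∀ r f → (3 + r) * (2 * f) + (2 * r + 2) * f ≡ 4 * ((2 + r) * f)
    second-size = solve-∀
    large-sizes : ∀ r z → (4 + r) * (6 * ((3 + r) * z)) + (30 * r * r + 66 * r) * z ≡ 36 * ((2 + r) * ((1 + r) * z))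
    large-sizes = solve-∀
    *-interchange : ∀ a b c d → a * b * (c * d) ≡ a * c * (b * d)
    *-interchange = solve-∀

  ^-distribʳ-* : (x y k : ℕ) → (x * y) ^ k ≡ x ^ k * y ^ k
  ^-distribʳ-* x y zero = refl
  ^-distribʳ-* x y (suc k) = trans (cong (x * y *_) (^-distribʳ-* x y k)) (*-interchange x y (x ^ k) (y ^ k))

  -- Estimates for d ≥ 2 and n ≥ 3, written d = e + 2 and n = r + 3.  Put b = (n−1)! and
  -- a k = k! (n−k)!, so that (n C k) · a k = n! = n b.
  module Estimates (r e : ℕ) where

    n d b : ℕ
    n = suc (suc (suc r))
    d = suc (suc e)
    b = suc (suc r) !

    a : ℕ → ℕ
    a k = k ! * (n ∸ k) !

    -- a is non-increasing on 1 ≤ k ≤ n/2, because (n−k) · a (k+1) = (k+1) · a k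
    a-step : (k : ℕ) → 2 * suc k ≤ n → a (suc k) ≤ a k
    a-step k 2[k+1]≤n = *-cancelˡ-≤ (n ∸ k) {{>-nonZero (m<n⇒0<n∸m k<n)}} (begin
      (n ∸ k) * a (suc k)  ≡⟨ [n-k]*d[k+1]≡[k+1]*d[k] k<n ⟩
      suc k * a k          ≤⟨ *-monoˡ-≤ (a k) k+1≤n∸k ⟩
      (n ∸ k) * a k        ∎)
      where
      open ≤-Reasoning
      k+[k+1]≤n : k + suc k ≤ n
      k+[k+1]≤n = ≤-trans (n≤1+n _) (subst (_≤ n) (sym (double-suc k)) 2[k+1]≤n)
      k<n : k < n
      k<n = m+n≤o⇒n≤o k k+[k+1]≤n
      k+1≤n∸k : suc k ≤ n ∸ k
      k+1≤n∸k = subst (_≤ n ∸ k) (m+n∸m≡n k (suc k)) (∸-monoˡ-≤ k k+[k+1]≤n)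

    a-mono : {j k : ℕ} → j ≤ k → 2 * k ≤ n → a k ≤ a j
    a-mono j≤k small with m≤n⇒m<n∨m≡n j≤k
    ... | inj₂ refl = ≤-refl
    a-mono {k = suc k} _ small | inj₁ (s≤s j≤k) =
      ≤-trans (a-step k small) (a-mono j≤k (≤-trans (*-monoʳ-≤ 2 (n≤1+n k)) small))

    a≤b : {k : ℕ} → 1 ≤ k → 2 * k ≤ n → a k ≤ b
    a≤b 1≤k small = ≤-trans (a-mono 1≤k small) (≤-reflexive (+-identityʳ b))

    term : ℕ → ℕ
    term k = (n C k) * a k ^ d

    term-≡ : {k : ℕ} → k ≤ n → term k ≡ n * b * a k ^ suc e
    term-≡ {k} k≤n = trans (sym (*-assoc (n C k) (a k) _)) (cong (_* a k ^ suc e) (nCk*k![n∸k]!≡n! k≤n))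

    term-1 : term 1 ≡ n * b ^ d
    term-1 = trans (term-≡ (s≤s z≤n)) (trans (cong (λ x → n * b * x ^ suc e) (+-identityʳ b)) (*-assoc n b (b ^ suc e)))

    term-2 : 2 * 2 ≤ n → term 2 ≤ 4 * b ^ d
    term-2 small = begin
      term 2                          ≡⟨ term-≡ (≤-trans (s≤s (s≤s z≤n)) small) ⟩
      n * b * (a 2 * a 2 ^ e)         ≤⟨ *-monoʳ-≤ (n * b) (*-monoʳ-≤ (a 2) (^-monoˡ-≤ e (a≤b {2} (s≤s z≤n) small))) ⟩
      n * b * (a 2 * b ^ e)           ≡⟨ *-interchange n b (a 2) (b ^ e) ⟩
      n * a 2 * (b * b ^ e)           ≤⟨ *-monoˡ-≤ (b * b ^ e) n·a2≤4b ⟩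
      4 * b * (b * b ^ e)             ≡⟨ *-assoc 4 b (b * b ^ e) ⟩
      4 * b ^ d                       ∎
      where
      open ≤-Reasoning
      n·a2≤4b : n * a 2 ≤ 4 * b
      n·a2≤4b = subst (n * a 2 ≤_) (second-size r (suc r !)) (m≤m+n (n * a 2) _)

    Qₗ : ℕ
    Qₗ = n * b * (a 3 * b ^ e)

    term-large : {k : ℕ} → 3 ≤ k → 2 * k ≤ n → term k ≤ Qₗ
    term-large {k} 3≤k small = begin
      term k                    ≡⟨ term-≡ (≤-trans (m≤n*m k 2) small) ⟩
      n * b * (a k * a k ^ e)   ≤⟨ *-monoʳ-≤ (n * b) (*-mono-≤ (a-mono 3≤k small) (^-monoˡ-≤ e (a≤b (≤-trans (s≤s z≤n) 3≤k) small))) ⟩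
      Qₗ                         ∎
      where open ≤-Reasoning

    large-total : (n + 1) * Qₗ ≤ 36 * b ^ d
    large-total = begin
      (n + 1) * Qₗ                                 ≡⟨ cong₂ _*_ (+-comm n 1) (reassociate n b (r !) (b ^ e)) ⟩
      (4 + r) * (6 * ((3 + r) * z))                ≤⟨ m≤m+n _ _ ⟩
      (4 + r) * (6 * ((3 + r) * z)) + (30 * r * r + 66 * r) * z ≡⟨ large-sizes r z ⟩
      36 * ((2 + r) * ((1 + r) * z))               ≡⟨ cong (36 *_) (unfold-b r (r !) b (b ^ e)) ⟨
      36 * b ^ d                                   ∎
      where
      open ≤-Reasoning
      z = r ! * (b * b ^ e)
      reassociate : ∀ n b f y → n * b * (6 * f * y) ≡ 6 * (n * (f * (b * y)))
      reassociate = solve-∀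
      -- b^d = b · b · b^e with the first factor b = (r+2)(r+1) r!
      unfold-b : ∀ r f b y → (2 + r) * ((1 + r) * f) * (b * y) ≡ (2 + r) * ((1 + r) * (f * (b * y)))
      unfold-b = solve-∀

    per-size : (k : ℕ) → k ≤ n →
      (n C k) * smallWeight n d k ≤ 𝟙 (k ≟ 1) * (n * b ^ d) + 𝟙 (k ≟ 2) * (4 * b ^ d) + Qₗ
    per-size k k≤n with small? n k
    ... | no _ = ≤-trans (≤-reflexive (*-zeroʳ (n C k))) z≤n
    ... | yes (1≤k , small) = ≤-trans (≤-reflexive (cong ((n C k) *_) (*-identityˡ _))) (by-size k 1≤k small)
      where
      by-size : (k : ℕ) → 1 ≤ k → 2 * k ≤ n → term k ≤ 𝟙 (k ≟ 1) * (n * b ^ d) + 𝟙 (k ≟ 2) * (4 * b ^ d) + Qₗ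
      by-size 1 _ _ = ≤-trans (≤-reflexive (trans term-1 (sym (trans (+-identityʳ _) (+-identityʳ _))))) (m≤m+n _ Qₗ)
      by-size 2 _ small = ≤-trans (term-2 small) (≤-trans (≤-reflexive (sym (+-identityʳ _))) (m≤m+n _ Qₗ))
      by-size (suc (suc (suc k))) _ small = ≤-trans (term-large (s≤s (s≤s (s≤s z≤n))) small) (m≤n+m Qₗ _)

    small-total : ∑[ k ← upTo (suc n) ] ((n C k) * smallWeight n d k) ≤ n * b ^ d + 40 * b ^ d
    small-total = begin
      ∑[ k ← upTo (suc n) ] ((n C k) * smallWeight n d k)
        ≤⟨ ∑-mono (upTo (suc n)) (λ k k∈ → per-size k (≤-pred (∈-upTo⁻ k∈))) ⟩
      ∑[ k ← upTo (suc n) ] (𝟙 (k ≟ 1) * (n * b ^ d) + 𝟙 (k ≟ 2) * (4 * b ^ d) + Qₗ)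
        ≡⟨ trans (∑-+ (upTo (suc n)) (λ k → one k + two k) (λ _ → Qₗ)) (cong₂ _+_ (∑-+ (upTo (suc n)) one two) (∑-const (upTo (suc n)) Qₗ)) ⟩
      ∑[ k ← upTo (suc n) ] (𝟙 (k ≟ 1) * (n * b ^ d)) + ∑[ k ← upTo (suc n) ] (𝟙 (k ≟ 2) * (4 * b ^ d)) + length (upTo (suc n)) * Qₗ
        ≡⟨ cong₂ _+_ (cong₂ _+_ (only 1 (n * b ^ d) (s≤s z≤n)) (only 2 (4 * b ^ d) (s≤s (s≤s z≤n)))) (cong (_* Qₗ) (trans (length-applyUpTo id (suc n)) (+-comm 1 n))) ⟩
      n * b ^ d + 4 * b ^ d + (n + 1) * Qₗ
        ≤⟨ +-monoʳ-≤ (n * b ^ d + 4 * b ^ d) large-total ⟩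
      n * b ^ d + 4 * b ^ d + 36 * b ^ d
        ≡⟨ trans (+-assoc (n * b ^ d) _ _) (cong (n * b ^ d +_) (sym (*-distribʳ-+ (b ^ d) 4 36))) ⟩
      n * b ^ d + 40 * b ^ d ∎
      where
      open ≤-Reasoning
      one two : ℕ → ℕ
      one k = 𝟙 (k ≟ 1) * (n * b ^ d)
      two k = 𝟙 (k ≟ 2) * (4 * b ^ d)
      only : (j X : ℕ) → j ≤ n → ∑[ k ← upTo (suc n) ] (𝟙 (k ≟ j) * X) ≡ X
      only j X j≤n = trans (∑-delta (upTo (suc n)) _ (Unique.upTo⁺ (suc n)) (∈-upTo⁺ (s≤s j≤n))
                             (λ k k≢j → cong (_* X) (𝟙-no (k ≟ j) k≢j)))
                           (trans (cong (_* X) (𝟙-yes (j ≟ j) refl)) (+-identityʳ X))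

    pairs-total : n * (n * (2 * suc r !) ^ d) ≤ 4 * 2 ^ d * b ^ d
    pairs-total = begin
      n * (n * (2 * f) ^ d)               ≡⟨ cong (λ x → n * (n * x)) (^-distribʳ-* 2 f d) ⟩
      n * (n * (2 ^ d * f ^ d))           ≡⟨ reassociate₁ n (2 ^ d) (f ^ d) ⟩
      n * n * 2 ^ d * f ^ d               ≤⟨ *-monoˡ-≤ (f ^ d) (*-monoˡ-≤ (2 ^ d) n²≤) ⟩
      4 * (2 + r) ^ d * 2 ^ d * f ^ d     ≡⟨ reassociate₂ 4 ((2 + r) ^ d) (2 ^ d) (f ^ d) ⟩
      4 * 2 ^ d * ((2 + r) ^ d * f ^ d)   ≡⟨ cong (4 * 2 ^ d *_) (^-distribʳ-* (2 + r) f d) ⟨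
      4 * 2 ^ d * b ^ d                   ∎
      where
      open ≤-Reasoning
      f = suc r !
      reassociate₁ : ∀ n t f → n * (n * (t * f)) ≡ n * n * t * f
      reassociate₁ = solve-∀
      reassociate₂ : ∀ c p t f → c * p * t * f ≡ c * t * (p * f)
      reassociate₂ = solve-∀
      n²≤ : n * n ≤ 4 * (2 + r) ^ d
      n²≤ = ≤-trans (subst (n * n ≤_) (square-bound r) (m≤m+n (n * n) _))
        (*-monoʳ-≤ 4 (subst (_≤ (2 + r) ^ d) (cong ((2 + r) *_) (*-identityʳ (2 + r)))
          (^-monoʳ-≤ (2 + r) {2} {d} (s≤s (s≤s z≤n)))))

  K : ℕ → ℕ
  K d = 40 + 4 * 2 ^ d

  connected-count : (r d : ℕ) → 1 ≤ d → (L : List (PermTuple (3 + r) d)) → Unique L →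
    ((σ : PermTuple (3 + r) d) → σ ∈ L ⇔ (AllPerms σ × Connected σ)) →
    let n = 3 + r ; b = (2 + r) ! in
    (length L + n * b ^ d ≤ (n !) ^ d + K d * b ^ d) × ((n !) ^ d ≤ length L + n * b ^ d + K d * b ^ d)
  connected-count r (suc zero) _ L L-unique L-spec = upper , lower
    where
    open ≤-Reasoning
    n = 3 + r
    b = (2 + r) !
    n!¹ : (n !) ^ 1 ≡ n * b ^ 1
    n!¹ = *-assoc n b 1
    upper : length L + n * b ^ 1 ≤ (n !) ^ 1 + K 1 * b ^ 1
    upper = begin
      length L + n * b ^ 1     ≤⟨ +-mono-≤ (≤-trans (cycle-bound L L-unique L-spec) (≤-trans (m≤m*n b 1) (m≤n*m (b ^ 1) (K 1))))
                                           (≤-reflexive (sym n!¹)) ⟩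
      K 1 * b ^ 1 + (n !) ^ 1  ≡⟨ +-comm (K 1 * b ^ 1) _ ⟩
      (n !) ^ 1 + K 1 * b ^ 1  ∎
    lower : (n !) ^ 1 ≤ length L + n * b ^ 1 + K 1 * b ^ 1
    lower = ≤-trans (≤-reflexive n!¹) (≤-trans (m≤n+m _ (length L)) (m≤m+n _ _))
  connected-count r (suc (suc e)) _ L L-unique L-spec = upper , lower
    where
    open Estimates r e
    open ≤-Reasoning
    upper : length L + n * b ^ d ≤ (n !) ^ d + K d * b ^ d
    upper = begin
      length L + n * b ^ d                       ≤⟨ UpperBound.upper-bound L L-unique L-spec ⟩
      (n !) ^ d + n * (n * (2 * suc r !) ^ d)    ≤⟨ +-monoʳ-≤ ((n !) ^ d) (≤-trans pairs-total (*-monoˡ-≤ (b ^ d) (m≤n+m (4 * 2 ^ d) 40))) ⟩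
      (n !) ^ d + K d * b ^ d                    ∎
    lower : (n !) ^ d ≤ length L + n * b ^ d + K d * b ^ d
    lower = begin
      (n !) ^ d                                                  ≤⟨ LowerBound.lower-bound L L-unique L-spec ⟩
      length L + ∑[ k ← upTo (suc n) ] ((n C k) * smallWeight n d k)
                                                                 ≤⟨ +-monoʳ-≤ (length L) small-total ⟩
      length L + (n * b ^ d + 40 * b ^ d)                        ≡⟨ +-assoc (length L) _ _ ⟨
      length L + n * b ^ d + 40 * b ^ d                          ≤⟨ +-monoʳ-≤ (length L + n * b ^ d) (*-monoˡ-≤ (b ^ d) (m≤m+n 40 (4 * 2 ^ d))) ⟩
      length L + n * b ^ d + K d * b ^ d                         ∎

open import Defs
open import Data.Nat using (ℕ; _≤_; _^_; _∸_; _!)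
open import Data.Rational using (ℚ; _-_; _+_; _*_; ∣_∣; 1ℚ) renaming (_≤_ to _≤ℚ_)
open import Data.List using (List; length)
open import Data.List.Relation.Unary.Unique.Propositional using (Unique)
open import Data.List.Membership.Propositional using (_∈_)
open import Data.Product using (∃; _×_; _,_; proj₁; proj₂)
open import Function.Bundles using (_⇔_)

import Data.Nat as ℕ
import Data.Nat.Properties as ℕ
open import Data.Nat using (suc; s≤s)
open import Data.Integer as ℤ using (+_; +≤+)
import Data.Integer.Properties as ℤ
import Data.Integer.Tactic.RingSolver as ℤ-Solver
import Data.Nat.Tactic.RingSolver as ℕ-Solver
open import Data.Rational using (toℚᵘ; -_)
import Data.Rational.Properties as ℚ
open import Data.Rational.Unnormalised as ℚᵘ using (mkℚᵘ; *≡*; *≤*)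
import Data.Rational.Unnormalised.Properties as ℚᵘ
open import Data.Rational.Solver using (module +-*-Solver)
open import Data.Sum using (inj₁; inj₂)
open import Relation.Binary.PropositionalEquality

-- Fractions a ÷ℕ t of naturals in ℚ (t ≥ 1).  Each identity is checked on the unnormalised
-- representatives a/t, where it is an identity of integers.
module Fractions where

  representative : (a t : ℕ) → toℚᵘ (a ÷ℕ suc t) ℚᵘ.≃ mkℚᵘ (+ a) t
  representative a t = ℚ.toℚᵘ-fromℚᵘ (mkℚᵘ (+ a) t)

  ÷ℕ-mono : (a b t : ℕ) → a ℕ.≤ b → (a ÷ℕ suc t) ≤ℚ (b ÷ℕ suc t)
  ÷ℕ-mono a b t a≤b = ℚ.toℚᵘ-cancel-≤ (ℚᵘ.≤-respˡ-≃ (ℚᵘ.≃-sym (representative a t))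
    (ℚᵘ.≤-respʳ-≃ (ℚᵘ.≃-sym (representative b t)) (*≤* (ℤ.*-monoʳ-≤-nonNeg (+ suc t) (+≤+ a≤b)))))

  ÷ℕ-+ : (a b t : ℕ) → ((a ℕ.+ b) ÷ℕ suc t) ≡ (a ÷ℕ suc t) + (b ÷ℕ suc t)
  ÷ℕ-+ a b t = ℚ.toℚᵘ-injective (ℚᵘ.≃-trans (representative (a ℕ.+ b) t)
    (ℚᵘ.≃-trans (*≡* integers) (ℚᵘ.≃-sym (ℚᵘ.≃-trans (ℚ.toℚᵘ-homo-+ (a ÷ℕ suc t) (b ÷ℕ suc t))
      (ℚᵘ.+-cong (representative a t) (representative b t))))))
    where
    integers : + (a ℕ.+ b) ℤ.* + (suc t ℕ.* suc t) ≡ (+ a ℤ.* + suc t ℤ.+ + b ℤ.* + suc t) ℤ.* + suc t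
    integers = begin
      + (a ℕ.+ b) ℤ.* + (suc t ℕ.* suc t)       ≡⟨ cong₂ ℤ._*_ (ℤ.pos-+ a b) (ℤ.pos-* (suc t) (suc t)) ⟩
      (+ a ℤ.+ + b) ℤ.* (+ suc t ℤ.* + suc t)   ≡⟨ distribute (+ a) (+ b) (+ suc t) ⟩
      (+ a ℤ.* + suc t ℤ.+ + b ℤ.* + suc t) ℤ.* + suc t ∎
      where
      open ≡-Reasoning
      distribute : ∀ x y z → (x ℤ.+ y) ℤ.* (z ℤ.* z) ≡ (x ℤ.* z ℤ.+ y ℤ.* z) ℤ.* z
      distribute = ℤ-Solver.solve-∀

  ÷ℕ-cancel : (a t s : ℕ) → ((a ℕ.* suc s) ÷ℕ (suc t ℕ.* suc s)) ≡ (a ÷ℕ suc t)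
  ÷ℕ-cancel a t s = ℚ.toℚᵘ-injective (ℚᵘ.≃-trans (representative (a ℕ.* suc s) _)
    (ℚᵘ.≃-trans (*≡* integers) (ℚᵘ.≃-sym (representative a t))))
    where
    integers : + (a ℕ.* suc s) ℤ.* + suc t ≡ + a ℤ.* + (suc t ℕ.* suc s)
    integers = begin
      + (a ℕ.* suc s) ℤ.* + suc t        ≡⟨ cong (ℤ._* + suc t) (ℤ.pos-* a (suc s)) ⟩
      + a ℤ.* + suc s ℤ.* + suc t        ≡⟨ rearrange (+ a) (+ suc s) (+ suc t) ⟩
      + a ℤ.* (+ suc t ℤ.* + suc s)      ≡⟨ cong (+ a ℤ.*_) (ℤ.pos-* (suc t) (suc s)) ⟨
      + a ℤ.* + (suc t ℕ.* suc s)        ∎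
      where
      open ≡-Reasoning
      rearrange : ∀ x y z → x ℤ.* y ℤ.* z ≡ x ℤ.* (z ℤ.* y)
      rearrange = ℤ-Solver.solve-∀

  ÷ℕ-self : (t : ℕ) → (suc t ÷ℕ suc t) ≡ 1ℚ
  ÷ℕ-self t = ℚ.toℚᵘ-injective (ℚᵘ.≃-trans (representative (suc t) t) (ℚᵘ.≃-trans (*≡* (ℤ.*-comm (+ suc t) (+ 1))) (ℚᵘ.≃-sym (representative 1 0))))

  ÷ℕ-scale : (a b t : ℕ) → (a ÷ℕ 1) * (b ÷ℕ suc t) ≡ ((a ℕ.* b) ÷ℕ suc t)
  ÷ℕ-scale a b t = ℚ.toℚᵘ-injective (ℚᵘ.≃-trans (ℚ.toℚᵘ-homo-* (a ÷ℕ 1) (b ÷ℕ suc t))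
    (ℚᵘ.≃-trans (ℚᵘ.*-cong (representative a 0) (representative b t))
      (ℚᵘ.≃-trans (*≡* integers) (ℚᵘ.≃-sym (representative (a ℕ.* b) t)))))
    where
    integers : + a ℤ.* + b ℤ.* + suc t ≡ + (a ℕ.* b) ℤ.* (+ 1 ℤ.* + suc t)
    integers = trans (cong (ℤ._* + suc t) (sym (ℤ.pos-* a b))) (cong (+ (a ℕ.* b) ℤ.*_) (sym (ℤ.*-identityˡ (+ suc t))))

  private
    add-sub : (y e : ℚ) → (y + e) - y ≡ e
    add-sub = solve 2 (λ y e → (y :+ e) :- y := e) refl
      where open +-*-Solver
    sub-swap : (x y : ℚ) → y - x ≡ - (x - y)
    sub-swap = solve 2 (λ x y → y :- x := :- (x :- y)) refl
      where open +-*-Solver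

  ∣-∣≤ : (x y e : ℚ) → x ≤ℚ y + e → y ≤ℚ x + e → ∣ x - y ∣ ≤ℚ e
  ∣-∣≤ x y e x≤ y≤ with ℚ.∣p∣≡p∨∣p∣≡-p (x - y)
  ... | inj₁ ∣z∣≡z = subst (_≤ℚ e) (sym ∣z∣≡z) (subst (x - y ≤ℚ_) (add-sub y e) (ℚ.+-monoˡ-≤ (- y) x≤))
  ... | inj₂ ∣z∣≡-z = subst (_≤ℚ e) (sym ∣z∣≡-z) (subst₂ _≤ℚ_ (sub-swap x y) (add-sub x e) (ℚ.+-monoˡ-≤ (- x) y≤))

open Fractions

-- Let T = (n!)^d = P · nB = Q · B with B = ((n−1)!)^d, P = n^(d−1), Q = n^d.
-- Then 1/P = nB/T and 1/Q = B/T, so the two counting inequalities say exactly that the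
-- fractions (|L| + nB)/T and T/T are within KB/T of each other.
fraction-estimate : (ℓ n B T P Q K : ℕ) → 1 ℕ.≤ n → 1 ℕ.≤ B → 1 ℕ.≤ P → 1 ℕ.≤ Q →
  T ≡ P ℕ.* (n ℕ.* B) → T ≡ Q ℕ.* B →
  ℓ ℕ.+ n ℕ.* B ℕ.≤ T ℕ.+ K ℕ.* B → T ℕ.≤ ℓ ℕ.+ n ℕ.* B ℕ.+ K ℕ.* B →
  ∣ (ℓ ÷ℕ T) - (1ℚ - (1 ÷ℕ P)) ∣ ≤ℚ (K ÷ℕ 1) * (1 ÷ℕ Q)
fraction-estimate ℓ n@(suc n′) B@(suc B′) T P@(suc P′) (suc Q′) K _ _ _ _ refl T≡QB upper lower =
  subst₂ (λ u v → ∣ u ∣ ≤ℚ v) (sym difference) (sym error)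
    (∣-∣≤ x y e (subst (x ≤ℚ_) (÷ℕ-+ T (K ℕ.* B) t) (÷ℕ-mono _ _ t upper))
                (subst (y ≤ℚ_) (÷ℕ-+ (ℓ ℕ.+ n ℕ.* B) (K ℕ.* B) t) (÷ℕ-mono _ _ t lower)))
  where
  -- the predecessors of n B and of T
  s t : ℕ
  s = B′ ℕ.+ n′ ℕ.* B
  t = s ℕ.+ P′ ℕ.* suc s
  x y e : ℚ
  x = (ℓ ℕ.+ n ℕ.* B) ÷ℕ T
  y = T ÷ℕ T
  e = (K ℕ.* B) ÷ℕ T
  open ≡-Reasoning
  one-over-P : (1 ÷ℕ P) ≡ ((n ℕ.* B) ÷ℕ T)
  one-over-P = sym (trans (cong (_÷ℕ T) (sym (ℕ.*-identityˡ (n ℕ.* B)))) (÷ℕ-cancel 1 P′ s))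
  difference : (ℓ ÷ℕ T) - (1ℚ - (1 ÷ℕ P)) ≡ x - y
  difference = begin
    (ℓ ÷ℕ T) - (1ℚ - (1 ÷ℕ P))                       ≡⟨ cong₂ (λ u v → (ℓ ÷ℕ T) - (u - v)) (sym (÷ℕ-self t)) one-over-P ⟩
    (ℓ ÷ℕ T) - (y - ((n ℕ.* B) ÷ℕ T))                ≡⟨ sub-sub (ℓ ÷ℕ T) y ((n ℕ.* B) ÷ℕ T) ⟩
    ((ℓ ÷ℕ T) + ((n ℕ.* B) ÷ℕ T)) - y                ≡⟨ cong (_- y) (÷ℕ-+ ℓ (n ℕ.* B) t) ⟨
    x - y                                            ∎
    where
    sub-sub : (a b c : ℚ) → a - (b - c) ≡ (a + c) - b
    sub-sub = solve 3 (λ a b c → a :- (b :- c) := (a :+ c) :- b) refl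
      where open +-*-Solver
  error : (K ÷ℕ 1) * (1 ÷ℕ suc Q′) ≡ e
  error = begin
    (K ÷ℕ 1) * (1 ÷ℕ suc Q′)              ≡⟨ ÷ℕ-scale K 1 Q′ ⟩
    (K ℕ.* 1) ÷ℕ suc Q′                   ≡⟨ cong (_÷ℕ suc Q′) (ℕ.*-identityʳ K) ⟩
    K ÷ℕ suc Q′                           ≡⟨ ÷ℕ-cancel K Q′ B′ ⟨
    (K ℕ.* B) ÷ℕ (suc Q′ ℕ.* B)           ≡⟨ cong ((K ℕ.* B) ÷ℕ_) T≡QB ⟨
    e                                     ∎

connectivity-estimate : (d′ r : ℕ) → let d = suc d′ ; n = suc (suc (suc r)) in
  (L : List (PermTuple n d)) → Unique L → ((σ : PermTuple n d) → (σ ∈ L) ⇔ (AllPerms σ × Connected σ)) →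
  ∣ (length L ÷ℕ ((n !) ^ d)) - (1ℚ - (1 ÷ℕ (n ^ d′))) ∣ ≤ℚ (Counting.K d ÷ℕ 1) * (1 ÷ℕ (n ^ d))
connectivity-estimate d′ r L L-unique L-spec =
  fraction-estimate (length L) n (b ^ d) ((n !) ^ d) (n ^ d′) (n ^ d) (Counting.K d)
    (s≤s ℕ.z≤n) (ℕ.m^n>0 b {{b≢0}} d) (ℕ.m^n>0 n d′) (ℕ.m^n>0 n d)
    (trans n!^d≡n^d·b^d (reassociate n (n ^ d′) (b ^ d))) n!^d≡n^d·b^d upper lower
  where
  d = suc d′
  n = suc (suc (suc r))
  b = suc (suc r) !
  b≢0 = suc (suc r) ℕ.!≢0
  n!^d≡n^d·b^d : (n !) ^ d ≡ n ^ d ℕ.* b ^ d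
  n!^d≡n^d·b^d = Counting.^-distribʳ-* n b d
  reassociate : ∀ x y z → x ℕ.* y ℕ.* z ≡ y ℕ.* (x ℕ.* z)
  reassociate = ℕ-Solver.solve-∀
  bounds = Counting.connected-count r d (s≤s ℕ.z≤n) L L-unique L-spec
  upper = proj₁ bounds
  lower = proj₂ bounds

theorem4p15 : (d : ℕ) → 1 ≤ d →
    ∃ λ (C : ℚ) → ∃ λ (N : ℕ) → (n : ℕ) → N ≤ n → 1 ≤ n →
    (L : List (PermTuple n d)) → Unique L →
    ((σ : PermTuple n d) → (σ ∈ L) ⇔ (AllPerms σ × Connected σ)) →
    ∣ (length L ÷ℕ ((n !) ^ d)) - (1ℚ - (1 ÷ℕ (n ^ (d ∸ 1)))) ∣ ≤ℚ C * (1 ÷ℕ (n ^ d))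
theorem4p15 (suc d′) _ = (Counting.K (suc d′) ÷ℕ 1) , 3 , λ where
  _ (s≤s (s≤s (s≤s (ℕ.z≤n {r})))) _ → connectivity-estimate d′ r
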